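{- Let $G$ be a connected graph with order $n(G)$, size $m(G)$ and maximum degree $\Delta(G)$. Then the following hold. (i) $\xi^d(G) - \xi^c(G) \ge 2\big(n(G)-1-\Delta(G)\big)\varepsilon(G)$. Moreover, equality holds if and only if $G$ is a regular graph with $\mathrm{diam}(G)\le 2$. (ii) $\xi^d(G) - \xi^c(G) \le 2n(G)\big(W(G)-m(G)\big) + M_1(G) - DD(G)$. Moreover, equality holds if and only if $G\in \{P_4\}\cup\{CP_{2k}\oplus K_{n(G)-2k} : 0\le k\le n(G)/2\}$.
   Context: All graphs are finite, simple and connected. For a vertex $v$ of $G$: $\deg(v)$ is its degree; $\varepsilon(v)=\max_{u\in V(G)} d(v,u)$ is its eccentricity; $D(v)=\sum_{u\in V(G)} d(v,u)$ is its total distance, where $d$ is the shortest-path distance. Define $\xi^c(G)=\sum_{v}\varepsilon(v)\deg(v)$ (eccentric connectivity index), $\xi^d(G)=\sum_{v}\varepsilon(v)D(v)$ (eccentric distance sum), $DD(G)=\sum_v \deg(v)D(v)$ (degree distance), $\varepsilon(G)=\sum_v \varepsilon(v)$, $W(G)=\sum_{\{u,v\}\subseteq V(G)} d(u,v)$ (Wiener index), $M_1(G)=\sum_v \deg(v)^2$ (first Zagreb index). $\mathrm{diam}(G)$ is the maximum eccentricity. A graph is regular if all vertices have the same degree. $P_4$ is the path on 4 vertices. The cocktail party graph $CP_{2k}$ is obtained from $K_{2k}$ by removing a perfect matching (so $CP_0$ is the empty graph and $CP_2$ consists of two nonadjacent vertices). The join $G\oplus H$ is the disjoint union of $G$ and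 $H$ together with all edges between a vertex of $G$ and a vertex of $H$; $K_j$ is the complete graph on $j$ vertices ($K_0$ empty). -}

module Defs where

open import Data.Nat using (ℕ; zero; suc; _+_; _*_; _⊔_; _<ᵇ_; _≡ᵇ_; _≤_; _/_)
open import Data.Bool using (Bool; true; false; _∧_; _∨_; not; if_then_else_)
open import Data.Fin using (Fin; toℕ; _≟_)
open import Data.Product using (Σ; ∃; _×_)
open import Data.Sum using (_⊎_)
open import Relation.Nullary.Decidable using (⌊_⌋)
open import Relation.Binary.PropositionalEquality using (_≡_)
open import Data.Fin.Permutation using (Permutation; _⟨$⟩ʳ_)

record Graph (n : ℕ) : Set where
  field
    adj    : Fin n → Fin n → Bool
    sym    : ∀ u v → adj u v ≡ adj v u
    irrefl : ∀ v → adj v v ≡ false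
open Graph public

sumFin : ∀ {n} → (Fin n → ℕ) → ℕ
sumFin {zero}  f = 0
sumFin {suc n} f = f Fin.zero + sumFin (λ i → f (Fin.suc i))

maxFin : ∀ {n} → (Fin n → ℕ) → ℕ
maxFin {zero}  f = 0
maxFin {suc n} f = f Fin.zero ⊔ maxFin (λ i → f (Fin.suc i))

anyFin : ∀ {n} → (Fin n → Bool) → Bool
anyFin {zero}  f = false
anyFin {suc n} f = f Fin.zero ∨ anyFin (λ i → f (Fin.suc i))

count : ∀ {n} → (Fin n → Bool) → ℕ
count f = sumFin (λ i → if f i then 1 else 0)

data Walk {n} (G : Graph n) : ℕ → Fin n → Fin n → Set where
  here : ∀ {u} → Walk G 0 u u
  step : ∀ {k u w v} → adj G u w ≡ true → Walk G k w v → Walk G (suc k) u v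

Connected : ∀ {n} → Graph n → Set
Connected G = ∀ u v → ∃ λ k → Walk G k u v

reachWithin : ∀ {n} → Graph n → ℕ → Fin n → Fin n → Bool
reachWithin G zero    u v = ⌊ u ≟ v ⌋
reachWithin G (suc k) u v =
  reachWithin G k u v ∨ anyFin (λ w → adj G u w ∧ reachWithin G k w v)

-- shortest-path distance: the number of k ∈ {0,…,n-1} such that v is not
-- reachable from u within k steps (= d(u,v) in a connected graph on n vertices)
dist : ∀ {n} → Graph n → Fin n → Fin n → ℕ
dist {n} G u v = count {n} (λ k → not (reachWithin G (toℕ k) u v))

deg : ∀ {n} → Graph n → Fin n → ℕ
deg G v = count (adj G v)

ecc : ∀ {n} → Graph n → Fin n → ℕ
ecc G v = maxFin (dist G v)

totDist : ∀ {n} → Graph n → Fin n → ℕ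
totDist G v = sumFin (dist G v)

maxDeg : ∀ {n} → Graph n → ℕ
maxDeg G = maxFin (deg G)

diam : ∀ {n} → Graph n → ℕ
diam G = maxFin (ecc G)

ξc : ∀ {n} → Graph n → ℕ
ξc G = sumFin (λ v → ecc G v * deg G v)

ξd : ∀ {n} → Graph n → ℕ
ξd G = sumFin (λ v → ecc G v * totDist G v)

DD : ∀ {n} → Graph n → ℕ
DD G = sumFin (λ v → deg G v * totDist G v)

εG : ∀ {n} → Graph n → ℕ
εG G = sumFin (ecc G)

wiener : ∀ {n} → Graph n → ℕ
wiener G = sumFin (λ u → sumFin (λ v → if toℕ u <ᵇ toℕ v then dist G u v else 0))

size : ∀ {n} → Graph n → ℕ
size G = sumFin (λ u → count (λ v → (toℕ u <ᵇ toℕ v) ∧ adj G u v))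

M₁ : ∀ {n} → Graph n → ℕ
M₁ G = sumFin (λ v → deg G v * deg G v)

Regular : ∀ {n} → Graph n → Set
Regular G = ∃ λ r → ∀ v → deg G v ≡ r

_≅_ : ∀ {m n} → Graph m → Graph n → Set
_≅_ {m} {n} G H = Σ (Permutation m n) λ π →
  ∀ u v → adj H (π ⟨$⟩ʳ u) (π ⟨$⟩ʳ v) ≡ adj G u v

P₄ : Graph 4
P₄ = record { adj = a ; sym = s ; irrefl = i }
  where
  a : Fin 4 → Fin 4 → Bool
  a u v = (suc (toℕ u) ≡ᵇ toℕ v) ∨ (suc (toℕ v) ≡ᵇ toℕ u)
  s : ∀ u v → a u v ≡ a v u
  s Fin.zero Fin.zero = _≡_.refl
  s Fin.zero (Fin.suc Fin.zero) = _≡_.refl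
  s Fin.zero (Fin.suc (Fin.suc Fin.zero)) = _≡_.refl
  s Fin.zero (Fin.suc (Fin.suc (Fin.suc Fin.zero))) = _≡_.refl
  s (Fin.suc Fin.zero) Fin.zero = _≡_.refl
  s (Fin.suc Fin.zero) (Fin.suc Fin.zero) = _≡_.refl
  s (Fin.suc Fin.zero) (Fin.suc (Fin.suc Fin.zero)) = _≡_.refl
  s (Fin.suc Fin.zero) (Fin.suc (Fin.suc (Fin.suc Fin.zero))) = _≡_.refl
  s (Fin.suc (Fin.suc Fin.zero)) Fin.zero = _≡_.refl
  s (Fin.suc (Fin.suc Fin.zero)) (Fin.suc Fin.zero) = _≡_.refl
  s (Fin.suc (Fin.suc Fin.zero)) (Fin.suc (Fin.suc Fin.zero)) = _≡_.refl
  s (Fin.suc (Fin.suc Fin.zero)) (Fin.suc (Fin.suc (Fin.suc Fin.zero))) = _≡_.refl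
  s (Fin.suc (Fin.suc (Fin.suc Fin.zero))) Fin.zero = _≡_.refl
  s (Fin.suc (Fin.suc (Fin.suc Fin.zero))) (Fin.suc Fin.zero) = _≡_.refl
  s (Fin.suc (Fin.suc (Fin.suc Fin.zero))) (Fin.suc (Fin.suc Fin.zero)) = _≡_.refl
  s (Fin.suc (Fin.suc (Fin.suc Fin.zero))) (Fin.suc (Fin.suc (Fin.suc Fin.zero))) = _≡_.refl
  i : ∀ v → a v v ≡ false
  i Fin.zero = _≡_.refl
  i (Fin.suc Fin.zero) = _≡_.refl
  i (Fin.suc (Fin.suc Fin.zero)) = _≡_.refl
  i (Fin.suc (Fin.suc (Fin.suc Fin.zero))) = _≡_.refl

-- CP_{2k} ⊕ K_{n-2k} on vertex set Fin n (for 2k ≤ n):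
-- vertices 0,…,2k-1 form the cocktail party part, with the removed perfect
-- matching {2j, 2j+1}; all other distinct pairs are adjacent.
cpAdj : (n k : ℕ) → Fin n → Fin n → Bool
cpAdj n k u v =
  not ⌊ u ≟ v ⌋ ∧
  not ((toℕ u <ᵇ 2 * k) ∧ (toℕ v <ᵇ 2 * k) ∧ (toℕ u / 2 ≡ᵇ toℕ v / 2))

IsCPJoin : ∀ {n} → Graph n → Set
IsCPJoin {n} G = ∃ λ k → (2 * k ≤ n) × Σ (Permutation n n) λ π →
  ∀ u v → cpAdj n k (π ⟨$⟩ʳ u) (π ⟨$⟩ʳ v) ≡ adj G u v

-- For a vertex v let D(v) be its total distance, and call v tight when ecc(v) + deg(v) = n.
-- Non-neighbours of v lie at distance at least 2, so D(v) + deg(v) + 2 = 2n + E(v) for an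
-- excess E(v) ≥ 0, and ξd − ξc − 2(n − 1 − Δ)ε = Σ ecc(v)(E(v) + 2(Δ − deg v)): this gives (i),
-- with equality exactly when all distances are at most 2 and all degrees equal Δ.
-- In a connected graph the ball of radius k around v grows with k until it covers the graph, so
-- ecc(v) + deg(v) ≤ n; with 2W = ΣD and 2m = Σ deg the slack in (ii) is
-- Σ (n − ecc(v) − deg(v))(D(v) − deg(v)), so equality says that every non-dominating vertex is
-- tight. Counting balls again, a tight vertex has at most one vertex at each distance ≥ 2.
-- If every degree is at least n − 2 the non-edges form a matching and G is a CP₂ₖ ⊕ Kₙ₋₂ₖ.
-- Otherwise a vertex farthest from a tight vertex of degree ≤ n − 3 is a tight leaf, whose
-- distances to the other vertices are all distinct, so G is a path, and a path on five or more
-- vertices has a non-dominating vertex with two vertices at distance 2; hence G ≅ P₄.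
module Submission where

open import Defs hiding (sym)

-- ℕ arithmetic is opened only inside this module, so that the theorem can use the integer operators.
module _ where
  import Algebra.Properties.CommutativeMonoid.Sum as CommutativeMonoidSum
  import Algebra.Properties.Semiring.Sum as SemiringSum
  open import Data.Bool using (Bool; true; false; _∧_; _∨_; not; if_then_else_; T)
  import Data.Bool.Properties as Bool
  open import Data.Bool.Properties using (∨-identityʳ; ∨-zeroʳ; ∧-conicalˡ; ∧-conicalʳ; ¬-not; not-¬; not-injective)
  open import Data.Empty using (⊥; ⊥-elim)
  open import Data.Fin using (Fin; zero; suc; toℕ; _≟_; fromℕ<; punchOut)
  open import Data.Fin.Properties using (any?; toℕ-injective; toℕ-fromℕ<; toℕ<n; punchIn-punchOut)
  import Data.Fin.Properties as Fin
  open import Data.Fin.Permutation using (Permutation; _⟨$⟩ʳ_; _⟨$⟩ˡ_; inverseˡ; inverseʳ; ↔⇒≡; permutation)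
  import Data.Fin.Permutation as Perm
  open import Data.List using (List; []; _∷_; length)
  open import Data.List.Relation.Unary.All as All using (All; []; _∷_)
  open import Data.List.Relation.Unary.AllPairs using ([]; _∷_)
  open import Data.List.Relation.Unary.Unique.Propositional using (Unique)
  open import Data.List.Relation.Unary.Any using (here; there)
  open import Data.List.Membership.Propositional using (_∈_)
  open import Data.Nat using (ℕ; zero; suc; _+_; _*_; _∸_; _⊔_; _≤_; _<_; _<ᵇ_; _≡ᵇ_; _/_; _%_; z≤n; s≤s; s≤s⁻¹)
  open import Data.Nat.DivMod using (m≡m%n+[m/n]*n; m%n<n; m/n≡1+[m∸n]/n)
  open import Data.Nat.Properties renaming (_≟_ to _≟ℕ_)
  open import Data.Nat.Solver using (module +-*-Solver)
  open import Data.Product using (Σ; ∃; _×_; _,_; proj₁; proj₂)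
  open import Data.Sum using (_⊎_; inj₁; inj₂)
  open import Function using (_∘_; case_of_; Equivalence; Injection; _⇔_; mk⇔)
  open import Function.Properties.Inverse using (↔⇒↣)
  open import Relation.Binary.PropositionalEquality
  open import Relation.Binary.Definitions using (tri<; tri≈; tri>)
  open import Relation.Nullary using (Dec; yes; no)
  open import Relation.Nullary.Decidable using (⌊_⌋; ⌊⌋-map′; _×-dec_; ¬?)

  open +-*-Solver using (solve; _:+_; _:*_; _:=_; con)

  ⌊≟⌋-refl : ∀ {n} (u : Fin n) → ⌊ u ≟ u ⌋ ≡ true
  ⌊≟⌋-refl u = cong ⌊_⌋ (≡-≟-identity _≟_ refl)

  ⌊≟⌋-≢ : ∀ {n} {u v : Fin n} → u ≢ v → ⌊ u ≟ v ⌋ ≡ false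
  ⌊≟⌋-≢ u≢v = cong ⌊_⌋ (≢-≟-identity _≟_ u≢v)

  ⌊≟⌋⇒≡ : ∀ {n} {u v : Fin n} → ⌊ u ≟ v ⌋ ≡ true → u ≡ v
  ⌊≟⌋⇒≡ {u = u} {v} h with u ≟ v
  ... | yes u≡v = u≡v

  ⌊suc≟suc⌋ : ∀ {n} (i j : Fin n) → ⌊ suc i ≟ suc j ⌋ ≡ ⌊ i ≟ j ⌋
  ⌊suc≟suc⌋ i j = ⌊⌋-map′ _ _ (i ≟ j)

  not⌊≟⌋⇒≢ : ∀ {n} {u v : Fin n} → not ⌊ u ≟ v ⌋ ≡ true → u ≢ v
  not⌊≟⌋⇒≢ {u = u} h refl rewrite ⌊≟⌋-refl u = case h of λ ()

  ∨-introˡ : ∀ {a} b → a ≡ true → a ∨ b ≡ true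
  ∨-introˡ b refl = refl

  ∨-introʳ : ∀ a {b} → b ≡ true → a ∨ b ≡ true
  ∨-introʳ a refl = ∨-zeroʳ a

  ∨-elim : ∀ {a b} → a ∨ b ≡ true → a ≡ true ⊎ b ≡ true
  ∨-elim {true}  _ = inj₁ refl
  ∨-elim {false} h = inj₂ h

  ≡true⇒T : ∀ {b} → b ≡ true → T b
  ≡true⇒T = Equivalence.from Bool.T-≡

  T⇒≡true : ∀ {b} → T b → b ≡ true
  T⇒≡true = Equivalence.to Bool.T-≡

  bool-ext : ∀ {a b} → (a ≡ true → b ≡ true) → (b ≡ true → a ≡ true) → a ≡ b
  bool-ext {false} {false} _   _   = refl
  bool-ext {false} {true}  _   b⇒a = b⇒a refl
  bool-ext {true}          a⇒b _   = sym (a⇒b refl)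

  anyFin-intro : ∀ {m} {f : Fin m → Bool} i → f i ≡ true → anyFin f ≡ true
  anyFin-intro zero    fi = ∨-introˡ _ fi
  anyFin-intro {f = f} (suc i) fi = ∨-introʳ (f zero) (anyFin-intro i fi)

  anyFin-elim : ∀ {m} {f : Fin m → Bool} → anyFin f ≡ true → ∃ λ i → f i ≡ true
  anyFin-elim {suc m} {f} h with ∨-elim {f zero} h
  ... | inj₁ f0 = zero , f0
  ... | inj₂ fs with anyFin-elim fs
  ...   | i , fi = suc i , fi

  module ∑ = SemiringSum +-*-semiring
  module ⨆ = CommutativeMonoidSum ⊔-0-commutativeMonoid

  sumFin≡sum : ∀ {n} (f : Fin n → ℕ) → sumFin f ≡ ∑.sum f
  sumFin≡sum {zero}  f = refl
  sumFin≡sum {suc n} f = cong (f zero +_) (sumFin≡sum (f ∘ suc))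

  maxFin≡sum : ∀ {n} (f : Fin n → ℕ) → maxFin f ≡ ⨆.sum f
  maxFin≡sum {zero}  f = refl
  maxFin≡sum {suc n} f = cong (f zero ⊔_) (maxFin≡sum (f ∘ suc))

  sumFin-cong : ∀ {n} {f g : Fin n → ℕ} → f ≗ g → sumFin f ≡ sumFin g
  sumFin-cong {zero}  f≗g = refl
  sumFin-cong {suc n} f≗g = cong₂ _+_ (f≗g zero) (sumFin-cong (f≗g ∘ suc))

  sumFin-mono-≤ : ∀ {n} {f g : Fin n → ℕ} → (∀ i → f i ≤ g i) → sumFin f ≤ sumFin g
  sumFin-mono-≤ {zero}  f≤g = z≤n
  sumFin-mono-≤ {suc n} f≤g = +-mono-≤ (f≤g zero) (sumFin-mono-≤ (f≤g ∘ suc))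

  sumFin-const : ∀ n c → sumFin {n} (λ _ → c) ≡ n * c
  sumFin-const zero    c = refl
  sumFin-const (suc n) c = cong (c +_) (sumFin-const n c)

  sumFin-zero : ∀ {n} {f : Fin n → ℕ} → (∀ i → f i ≡ 0) → sumFin f ≡ 0
  sumFin-zero {n} f≗0 = trans (sumFin-cong f≗0) (trans (sumFin-const n 0) (*-zeroʳ n))

  sumFin≡0⇒≡0 : ∀ {n} (f : Fin n → ℕ) → sumFin f ≡ 0 → ∀ i → f i ≡ 0
  sumFin≡0⇒≡0 f Σ≡0 zero    = m+n≡0⇒m≡0 (f zero) Σ≡0
  sumFin≡0⇒≡0 f Σ≡0 (suc i) = sumFin≡0⇒≡0 (f ∘ suc) (m+n≡0⇒n≡0 (f zero) Σ≡0) i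

  sumFin-distrib-+ : ∀ {n} (f g : Fin n → ℕ) → sumFin (λ i → f i + g i) ≡ sumFin f + sumFin g
  sumFin-distrib-+ f g = begin
    sumFin (λ i → f i + g i)  ≡⟨ sumFin≡sum (λ i → f i + g i) ⟩
    ∑.sum (λ i → f i + g i)   ≡⟨ ∑.∑-distrib-+ f g ⟩
    ∑.sum f + ∑.sum g         ≡⟨ cong₂ _+_ (sumFin≡sum f) (sumFin≡sum g) ⟨
    sumFin f + sumFin g       ∎
    where open ≡-Reasoning

  sumFin-distribˡ-* : ∀ {n} c (f : Fin n → ℕ) → sumFin (λ i → c * f i) ≡ c * sumFin f
  sumFin-distribˡ-* c f = begin
    sumFin (λ i → c * f i)  ≡⟨ sumFin≡sum (λ i → c * f i) ⟩
    ∑.sum (λ i → c * f i)   ≡⟨ ∑.*-distribˡ-sum c f ⟨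
    c * ∑.sum f             ≡⟨ cong (c *_) (sumFin≡sum f) ⟨
    c * sumFin f            ∎
    where open ≡-Reasoning

  sumFin-comm : ∀ {m n} (f : Fin m → Fin n → ℕ) →
    sumFin (λ i → sumFin (f i)) ≡ sumFin (λ j → sumFin (λ i → f i j))
  sumFin-comm f = begin
    sumFin (λ i → sumFin (f i))            ≡⟨ double f ⟩
    ∑.sum (λ i → ∑.sum (f i))              ≡⟨ ∑.∑-comm f ⟩
    ∑.sum (λ j → ∑.sum (λ i → f i j))      ≡⟨ double (λ j i → f i j) ⟨
    sumFin (λ j → sumFin (λ i → f i j))    ∎
    where
    open ≡-Reasoning
    double : ∀ {m n} (g : Fin m → Fin n → ℕ) → sumFin (λ i → sumFin (g i)) ≡ ∑.sum (λ i → ∑.sum (g i))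
    double g = trans (sumFin-cong (sumFin≡sum ∘ g)) (sumFin≡sum (λ i → ∑.sum (g i)))

  sumFin-linear : ∀ {n} (f : Fin n → ℕ) c (g : Fin n → ℕ) →
    sumFin (λ i → f i + c * g i) ≡ sumFin f + c * sumFin g
  sumFin-linear f c g = trans (sumFin-distrib-+ f (λ i → c * g i)) (cong (sumFin f +_) (sumFin-distribˡ-* c g))

  sumFin-permute : ∀ {n} (f : Fin n → ℕ) (π : Permutation n n) → sumFin f ≡ sumFin (f ∘ (π ⟨$⟩ʳ_))
  sumFin-permute f π = trans (sumFin≡sum f) (trans (∑.sum-permute f π) (sym (sumFin≡sum (f ∘ (π ⟨$⟩ʳ_)))))

  maxFin-permute : ∀ {n} (f : Fin n → ℕ) (π : Permutation n n) → maxFin f ≡ maxFin (f ∘ (π ⟨$⟩ʳ_))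
  maxFin-permute f π = trans (maxFin≡sum f) (trans (⨆.sum-permute f π) (sym (maxFin≡sum (f ∘ (π ⟨$⟩ʳ_)))))

  maxFin-cong : ∀ {n} {f g : Fin n → ℕ} → f ≗ g → maxFin f ≡ maxFin g
  maxFin-cong {zero}  f≗g = refl
  maxFin-cong {suc n} f≗g = cong₂ _⊔_ (f≗g zero) (maxFin-cong (f≗g ∘ suc))

  maxFin-upper : ∀ {n} (f : Fin n → ℕ) i → f i ≤ maxFin f
  maxFin-upper f zero    = m≤m⊔n _ _
  maxFin-upper f (suc i) = ≤-trans (maxFin-upper (f ∘ suc) i) (m≤n⊔m (f zero) _)

  maxFin-lub : ∀ {n} (f : Fin n → ℕ) {b} → (∀ i → f i ≤ b) → maxFin f ≤ b
  maxFin-lub {zero}  f f≤b = z≤n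
  maxFin-lub {suc n} f f≤b = ⊔-lub (f≤b zero) (maxFin-lub (f ∘ suc) (f≤b ∘ suc))

  maxFin-attained : ∀ {n} (f : Fin n → ℕ) → Fin n → ∃ λ i → f i ≡ maxFin f
  maxFin-attained {suc n} f _ = attained f
    where
    attained : ∀ {m} (g : Fin (suc m) → ℕ) → ∃ λ i → g i ≡ maxFin g
    attained {zero} g = zero , sym (⊔-identityʳ (g zero))
    attained {suc m} g with ⊔-sel (g zero) (maxFin (g ∘ suc)) | attained (g ∘ suc)
    ... | inj₁ max≡g0   | _        = zero , sym max≡g0
    ... | inj₂ max≡rest | i , gi≡  = suc i , trans gi≡ (sym max≡rest)

  sumFin-unordered-pairs : ∀ {n} (f : Fin n → Fin n → ℕ) → (∀ u v → f u v ≡ f v u) → (∀ u → f u u ≡ 0) →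
    2 * sumFin (λ u → sumFin (λ v → if toℕ u <ᵇ toℕ v then f u v else 0)) ≡ sumFin (λ u → sumFin (f u))
  sumFin-unordered-pairs {n} f f-sym f-diag = sym (begin
    sumFin (λ u → sumFin (f u))                          ≡⟨ sumFin-cong (λ u → sumFin-cong (split u)) ⟩
    sumFin (λ u → sumFin (λ v → g u v + g v u))          ≡⟨ sumFin-cong (λ u → sumFin-distrib-+ (g u) (λ v → g v u)) ⟩
    sumFin (λ u → sumFin (g u) + sumFin (λ v → g v u))   ≡⟨ sumFin-distrib-+ (λ u → sumFin (g u)) _ ⟩
    A + sumFin (λ u → sumFin (λ v → g v u))              ≡⟨ cong (A +_) (sumFin-comm g) ⟨
    A + A                                                ≡⟨ cong (A +_) (+-identityʳ A) ⟨
    2 * A                                                ∎)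
    where
    open ≡-Reasoning
    g : Fin n → Fin n → ℕ
    g u v = if toℕ u <ᵇ toℕ v then f u v else 0
    A : ℕ
    A = sumFin (λ u → sumFin (g u))
    split : ∀ u v → f u v ≡ g u v + g v u
    split u v with toℕ u <ᵇ toℕ v in u<v | toℕ v <ᵇ toℕ u in v<u
    ... | true  | true  =
      ⊥-elim (<-asym (<ᵇ⇒< (toℕ u) (toℕ v) (≡true⇒T u<v)) (<ᵇ⇒< (toℕ v) (toℕ u) (≡true⇒T v<u)))
    ... | true  | false = sym (+-identityʳ _)
    ... | false | true  = f-sym u v
    ... | false | false = trans (cong (λ w → f w v) u≡v) (f-diag v)
      where
      u≡v : u ≡ v
      u≡v = toℕ-injective (≤-antisym (≮⇒≥ λ v<u′ → subst T v<u (<⇒<ᵇ v<u′))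
                                     (≮⇒≥ λ u<v′ → subst T u<v (<⇒<ᵇ u<v′)))

  indicator : Bool → ℕ
  indicator b = if b then 1 else 0

  infix 4 _⊆ᵇ_
  _⊆ᵇ_ : ∀ {n} → (Fin n → Bool) → (Fin n → Bool) → Set
  f ⊆ᵇ g = ∀ i → f i ≡ true → g i ≡ true

  count-cong : ∀ {n} {f g : Fin n → Bool} → f ≗ g → count f ≡ count g
  count-cong f≗g = sumFin-cong (cong indicator ∘ f≗g)

  count-mono : ∀ {n} {f g : Fin n → Bool} → f ⊆ᵇ g → count f ≤ count g
  count-mono f⊆g = sumFin-mono-≤ λ i → indicator-mono (f⊆g i)
    where
    indicator-mono : ∀ {a b} → (a ≡ true → b ≡ true) → indicator a ≤ indicator b
    indicator-mono {false} _   = z≤n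
    indicator-mono {true}  a⇒b rewrite a⇒b refl = ≤-refl

  count-false : ∀ {n} {f : Fin n → Bool} → (∀ i → f i ≡ false) → count f ≡ 0
  count-false f≗false = sumFin-zero (cong indicator ∘ f≗false)

  count-compl : ∀ {n} (f : Fin n → Bool) → count f + count (not ∘ f) ≡ n
  count-compl {n} f = begin
    count f + count (not ∘ f)                                ≡⟨ sumFin-distrib-+ (indicator ∘ f) (indicator ∘ not ∘ f) ⟨
    sumFin (λ i → indicator (f i) + indicator (not (f i)))  ≡⟨ sumFin-cong (indicator-compl ∘ f) ⟩
    sumFin {n} (λ _ → 1)                                     ≡⟨ sumFin-const n 1 ⟩
    n * 1                                                    ≡⟨ *-identityʳ n ⟩
    n                                                        ∎
    where
    open ≡-Reasoning
    indicator-compl : ∀ b → indicator b + indicator (not b) ≡ 1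
    indicator-compl false = refl
    indicator-compl true  = refl

  count-true : ∀ n → count {n} (λ _ → true) ≡ n
  count-true n = trans (sumFin-const n 1) (*-identityʳ n)

  count≤n : ∀ {n} (f : Fin n → Bool) → count f ≤ n
  count≤n f = subst (count f ≤_) (count-compl f) (m≤m+n _ _)

  count-∨ : ∀ {n} (f g : Fin n → Bool) → count (λ i → f i ∨ g i) ≤ count f + count g
  count-∨ f g = ≤-trans (sumFin-mono-≤ λ i → indicator-∨ (f i) (g i))
                        (≤-reflexive (sumFin-distrib-+ (indicator ∘ f) (indicator ∘ g)))
    where
    indicator-∨ : ∀ a b → indicator (a ∨ b) ≤ indicator a + indicator b
    indicator-∨ false b = ≤-refl
    indicator-∨ true  b = s≤s z≤n

  count-insert : ∀ {n} (f : Fin n → Bool) a → f a ≡ false →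
    count (λ i → f i ∨ ⌊ i ≟ a ⌋) ≡ suc (count f)
  count-insert {suc n} f zero fa rewrite fa =
    cong suc (count-cong λ i → ∨-identityʳ (f (suc i)))
  count-insert {suc n} f (suc a) fa = trans (cong₂ _+_ (cong indicator (∨-identityʳ (f zero))) insert-tail) (+-suc _ _)
    where
    insert-tail : count (λ i → f (suc i) ∨ ⌊ suc i ≟ suc a ⌋) ≡ suc (count (f ∘ suc))
    insert-tail = trans (count-cong λ i → cong (f (suc i) ∨_) (⌊suc≟suc⌋ i a))
                        (count-insert (f ∘ suc) a fa)

  count-single : ∀ {n} (a : Fin n) → count (λ i → ⌊ i ≟ a ⌋) ≡ 1
  count-single {n} a = trans (count-insert (λ _ → false) a refl) (cong suc (count-false {n} λ _ → refl))

  count-+-distinct : ∀ {n} {f g : Fin n → Bool} (xs : List (Fin n)) → Unique xs → f ⊆ᵇ g →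
    All (λ i → g i ≡ true × f i ≡ false) xs → count f + length xs ≤ count g
  count-+-distinct [] _ f⊆g [] = ≤-trans (≤-reflexive (+-identityʳ _)) (count-mono f⊆g)
  count-+-distinct {f = f} {g} (a ∷ xs) (a∉xs ∷ unique) f⊆g ((ga , fa) ∷ new) = begin
    count f + suc (length xs)  ≡⟨ +-suc (count f) (length xs) ⟩
    suc (count f) + length xs  ≡⟨ cong (_+ length xs) (count-insert f a fa) ⟨
    count f′ + length xs         ≤⟨ count-+-distinct xs unique f′⊆g (All.zipWith still-new (a∉xs , new)) ⟩
    count g                      ∎
    where
    open ≤-Reasoning
    f′ : Fin _ → Bool
    f′ i = f i ∨ ⌊ i ≟ a ⌋
    f′⊆g : f′ ⊆ᵇ g
    f′⊆g i f′i with ∨-elim f′i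
    ... | inj₁ fi  = f⊆g i fi
    ... | inj₂ i≡a rewrite ⌊≟⌋⇒≡ i≡a = ga
    still-new : ∀ {i} → a ≢ i × (g i ≡ true × f i ≡ false) → g i ≡ true × f′ i ≡ false
    still-new (a≢i , gi , fi) rewrite fi | ⌊≟⌋-≢ (a≢i ∘ sym) = gi , refl

  count-≥-distinct : ∀ {n} {g : Fin n → Bool} (xs : List (Fin n)) → Unique xs →
    All (λ i → g i ≡ true) xs → length xs ≤ count g
  count-≥-distinct {n} {g} xs unique gs =
    subst (_≤ count g) (cong (_+ length xs) (count-false {n} {λ _ → false} λ _ → refl))
      (count-+-distinct {f = λ _ → false} {g} xs unique (λ _ ()) (All.map (_, refl) gs))

  count-< : ∀ {n} {f g : Fin n → Bool} a → f ⊆ᵇ g → g a ≡ true → f a ≡ false → count f < count g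
  count-< {f = f} {g} a f⊆g ga fa =
    subst (_≤ count g) (+-comm (count f) 1) (count-+-distinct (a ∷ []) ([] ∷ []) f⊆g ((ga , fa) ∷ []))

  count<n : ∀ {n} (f : Fin n → Bool) a → f a ≡ false → count f < n
  count<n {n} f a fa = subst (count f <_) (count-true n) (count-< a (λ _ _ → refl) refl fa)

  count-≤-cover : ∀ {n} (f : Fin n → Bool) (xs : List (Fin n)) →
    (∀ i → f i ≡ true → i ∈ xs) → count f ≤ length xs
  count-≤-cover f [] covered = ≤-reflexive (count-false λ i → ¬-not λ fi → case covered i fi of λ ())
  count-≤-cover f (a ∷ xs) covered = begin
    count f                                         ≤⟨ count-mono split ⟩
    count (λ i → ⌊ i ≟ a ⌋ ∨ f′ i)                  ≤⟨ count-∨ (λ i → ⌊ i ≟ a ⌋) f′ ⟩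
    count (λ i → ⌊ i ≟ a ⌋) + count f′              ≤⟨ +-mono-≤ (≤-reflexive (count-single a)) (count-≤-cover f′ xs covered′) ⟩
    suc (length xs)                               ∎
    where
    open ≤-Reasoning
    f′ : Fin _ → Bool
    f′ i = f i ∧ not ⌊ i ≟ a ⌋
    split : f ⊆ᵇ (λ i → ⌊ i ≟ a ⌋ ∨ f′ i)
    split i fi with i ≟ a
    ... | yes _ = refl
    ... | no  _ rewrite fi = refl
    covered′ : ∀ i → f′ i ≡ true → i ∈ xs
    covered′ i f′i with covered i (∧-conicalˡ (f i) _ f′i)
    ... | here i≡a   = ⊥-elim (not⌊≟⌋⇒≢ (∧-conicalʳ (f i) _ f′i) i≡a)
    ... | there i∈xs = i∈xs

  count-≤-prefix : ∀ {m} (f : Fin m → Bool) k → (∀ i → k ≤ toℕ i → f i ≡ false) → count f ≤ k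
  count-≤-prefix {zero}  f k       _ = z≤n
  count-≤-prefix {suc m} f zero  f≡false rewrite f≡false zero z≤n =
    count-≤-prefix (f ∘ suc) 0 (λ i _ → f≡false (suc i) z≤n)
  count-≤-prefix {suc m} f (suc k) f≡false with f zero
  ... | true  = s≤s (count-≤-prefix (f ∘ suc) k (λ i k≤i → f≡false (suc i) (s≤s k≤i)))
  ... | false = m≤n⇒m≤1+n (count-≤-prefix (f ∘ suc) k (λ i k≤i → f≡false (suc i) (s≤s k≤i)))

  count->-prefix : ∀ {m} (f : Fin m → Bool) k → (∀ i → toℕ i ≤ k → f i ≡ true) → k < m → k < count f
  count->-prefix {suc m} f zero    f≡true _ rewrite f≡true zero z≤n = s≤s z≤n
  count->-prefix {suc m} f (suc k) f≡true (s≤s k<m) rewrite f≡true zero z≤n =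
    s≤s (count->-prefix (f ∘ suc) k (λ i i≤k → f≡true (suc i) (s≤s i≤k)) k<m)

  -- Reachability and distance

  module Reachability {n} (G : Graph n) where

    R : ℕ → Fin n → Fin n → Bool
    R = reachWithin G

    reach-suc : ∀ k x c → R k x c ≡ true → R (suc k) x c ≡ true
    reach-suc k x c = ∨-introˡ _

    reach-mono : ∀ {k m} x c → k ≤ m → R k x c ≡ true → R m x c ≡ true
    reach-mono {k} {m} x c k≤m r with m≤n⇒∃[o]m+o≡n k≤m
    ... | o , refl = extend o
      where
      extend : ∀ o → R (k + o) x c ≡ true
      extend zero    = subst (λ j → R j x c ≡ true) (sym (+-identityʳ k)) r
      extend (suc o) = subst (λ j → R j x c ≡ true) (sym (+-suc k o)) (reach-suc (k + o) x c (extend o))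

    reach-step : ∀ k {x w} c → adj G x w ≡ true → R k w c ≡ true → R (suc k) x c ≡ true
    reach-step k {x} {w} c xw r = ∨-introʳ (R k x c) (anyFin-intro w (subst (λ b → b ∧ R k w c ≡ true) (sym xw) r))

    reach-step⁻ : ∀ k x c → R (suc k) x c ≡ true →
      R k x c ≡ true ⊎ ∃ λ w → adj G x w ≡ true × R k w c ≡ true
    reach-step⁻ k x c r with ∨-elim {R k x c} r
    ... | inj₁ r′ = inj₁ r′
    ... | inj₂ r′ with anyFin-elim r′
    ...   | w , xw∧r = inj₂ (w , ∧-conicalˡ _ _ xw∧r , ∧-conicalʳ _ _ xw∧r)

    walk⇒reach : ∀ {k x c} → Walk G k x c → R k x c ≡ true
    walk⇒reach {x = x} here = ⌊≟⌋-refl x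
    walk⇒reach {suc k} {c = c} (step xw walk) = reach-step k c xw (walk⇒reach walk)

    reach⇒walk : ∀ k x c → R k x c ≡ true → ∃ λ j → j ≤ k × Walk G j x c
    reach⇒walk zero x c r rewrite ⌊≟⌋⇒≡ r = 0 , z≤n , here
    reach⇒walk (suc k) x c r with reach-step⁻ k x c r
    ... | inj₁ r′ with reach⇒walk k x c r′
    ...   | j , j≤k , walk = j , m≤n⇒m≤1+n j≤k , walk
    reach⇒walk (suc k) x c r | inj₂ (w , xw , r′) with reach⇒walk k w c r′
    ...   | j , j≤k , walk = suc j , s≤s j≤k , step xw walk

    walk-reverse : ∀ {j u v} → Walk G j u v → Walk G j v u
    walk-reverse here = here
    walk-reverse {u = u} (step {w = w} uw walk) = snoc (walk-reverse walk) (trans (Graph.sym G w u) uw)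
      where
      snoc : ∀ {j u w v} → Walk G j u w → adj G w v ≡ true → Walk G (suc j) u v
      snoc here         wv = step wv here
      snoc (step uw′ p) wv = step uw′ (snoc p wv)

    reach-sym : ∀ k u v → R k u v ≡ R k v u
    reach-sym k u v = bool-ext (flip-reach u v) (flip-reach v u)
      where
      flip-reach : ∀ u v → R k u v ≡ true → R k v u ≡ true
      flip-reach u v r with reach⇒walk k u v r
      ... | j , j≤k , walk = reach-mono v u j≤k (walk⇒reach (walk-reverse walk))

    reach-1⇒ : ∀ x c → R 1 x c ≡ true → x ≡ c ⊎ adj G x c ≡ true
    reach-1⇒ x c r with reach-step⁻ 0 x c r
    ... | inj₁ x≡c = inj₁ (⌊≟⌋⇒≡ x≡c)
    ... | inj₂ (w , xw , w≡c) = inj₂ (subst (λ y → adj G x y ≡ true) (⌊≟⌋⇒≡ w≡c) xw)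

    adj⇒reach-1 : ∀ {x c} → adj G x c ≡ true → R 1 x c ≡ true
    adj⇒reach-1 {c = c} xc = reach-step 0 c xc (⌊≟⌋-refl c)

    reach⇒dist≤ : ∀ k u v → R k u v ≡ true → dist G u v ≤ k
    reach⇒dist≤ k u v r =
      count-≤-prefix {n} (λ i → not (R (toℕ i) u v)) k λ i k≤i → cong not (reach-mono u v k≤i r)

    unreach⇒dist> : ∀ k u v → R k u v ≡ false → k < n → k < dist G u v
    unreach⇒dist> k u v ¬r k<n = count->-prefix {n} (λ i → not (R (toℕ i) u v)) k unreached k<n
      where
      unreached : ∀ i → toℕ i ≤ k → not (R (toℕ i) u v) ≡ true
      unreached i i≤k with R (toℕ i) u v in e
      ... | true  = case trans (sym (reach-mono u v i≤k e)) ¬r of λ ()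
      ... | false = refl

    dist-sym : ∀ u v → dist G u v ≡ dist G v u
    dist-sym u v = count-cong {n} λ i → cong not (reach-sym (toℕ i) u v)

    dist-self : ∀ u → dist G u u ≡ 0
    dist-self u = n≤0⇒n≡0 (reach⇒dist≤ 0 u u (⌊≟⌋-refl u))

    adj⇒dist≤1 : ∀ {u v} → adj G u v ≡ true → dist G u v ≤ 1
    adj⇒dist≤1 {u} {v} uv = reach⇒dist≤ 1 u v (adj⇒reach-1 uv)

    ≢⇒dist≥1 : ∀ {u v} → u ≢ v → 1 ≤ dist G u v
    ≢⇒dist≥1 {u} {v} u≢v = unreach⇒dist> 0 u v (⌊≟⌋-≢ u≢v) (nonempty u)
      where
      nonempty : Fin n → 0 < n
      nonempty zero    = s≤s z≤n
      nonempty (suc _) = s≤s z≤n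

    common-neighbour⇒dist≤2 : ∀ {u w v} → adj G u w ≡ true → adj G w v ≡ true → dist G u v ≤ 2
    common-neighbour⇒dist≤2 {u} {w} {v} uw wv = reach⇒dist≤ 2 u v (reach-step 1 v uw (adj⇒reach-1 wv))

    nonadj⇒dist≥2 : ∀ {u v} → u ≢ v → adj G u v ≡ false → 2 ≤ dist G u v
    nonadj⇒dist≥2 {u} {v} u≢v ¬uv = unreach⇒dist> 1 u v ¬r (two-vertices u≢v)
      where
      ¬r : R 1 u v ≡ false
      ¬r = ¬-not λ r → case reach-1⇒ u v r of λ where
        (inj₁ u≡v) → u≢v u≡v
        (inj₂ uv)  → not-¬ uv ¬uv
      two-vertices : ∀ {m} {a b : Fin m} → a ≢ b → 1 < m
      two-vertices {suc zero} {zero} {zero} a≢b = ⊥-elim (a≢b refl)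
      two-vertices {suc (suc _)} _ = s≤s (s≤s z≤n)

  module TotalDistance {n} (G : Graph n) where
    open Reachability G

    distLowerBound : Fin n → Fin n → ℕ
    distLowerBound v x = if ⌊ x ≟ v ⌋ then 0 else if adj G v x then 1 else 2

    distLowerBound≤dist : ∀ v x → distLowerBound v x ≤ dist G v x
    distLowerBound≤dist v x with x ≟ v
    ... | yes _  = z≤n
    ... | no x≢v with adj G v x in vx
    ...   | true  = ≢⇒dist≥1 (x≢v ∘ sym)
    ...   | false = nonadj⇒dist≥2 (x≢v ∘ sym) vx

    distLowerBound≤2 : ∀ v x → distLowerBound v x ≤ 2
    distLowerBound≤2 v x with ⌊ x ≟ v ⌋ | adj G v x
    ... | true  | _     = z≤n
    ... | false | true  = s≤s z≤n
    ... | false | false = ≤-refl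

    dist≤2⇒dist≡distLowerBound : ∀ v x → dist G v x ≤ 2 → dist G v x ≡ distLowerBound v x
    dist≤2⇒dist≡distLowerBound v x d≤2 with x ≟ v
    ... | yes refl = dist-self x
    ... | no x≢v with adj G v x in vx
    ...   | true  = ≤-antisym (adj⇒dist≤1 vx) (≢⇒dist≥1 (x≢v ∘ sym))
    ...   | false = ≤-antisym d≤2 (nonadj⇒dist≥2 (x≢v ∘ sym) vx)

    sum-distLowerBound : ∀ v → sumFin (distLowerBound v) + deg G v + 2 ≡ 2 * n
    sum-distLowerBound v = begin
      sumFin (distLowerBound v) + deg G v + 2
        ≡⟨ cong (sumFin (distLowerBound v) + deg G v +_) (cong (2 *_) (count-single v)) ⟨
      sumFin (distLowerBound v) + deg G v + 2 * count (λ x → ⌊ x ≟ v ⌋)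
        ≡⟨ cong₂ _+_ (sumFin-distrib-+ (distLowerBound v) (indicator ∘ adj G v))
                     (sumFin-distribˡ-* 2 (indicator ∘ λ x → ⌊ x ≟ v ⌋)) ⟨
      sumFin (λ x → distLowerBound v x + indicator (adj G v x)) + sumFin (λ x → 2 * indicator ⌊ x ≟ v ⌋)
        ≡⟨ sumFin-distrib-+ (λ x → distLowerBound v x + indicator (adj G v x)) _ ⟨
      sumFin (λ x → distLowerBound v x + indicator (adj G v x) + 2 * indicator ⌊ x ≟ v ⌋)
        ≡⟨ sumFin-cong pointwise ⟩
      sumFin {n} (λ _ → 2)
        ≡⟨ trans (sumFin-const n 2) (*-comm n 2) ⟩
      2 * n ∎
      where
      open ≡-Reasoning
      pointwise : ∀ x → distLowerBound v x + indicator (adj G v x) + 2 * indicator ⌊ x ≟ v ⌋ ≡ 2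
      pointwise x with x ≟ v
      ... | yes refl rewrite irrefl G x = refl
      ... | no _ with adj G v x
      ...   | true  = refl
      ...   | false = refl

    distExcess : Fin n → ℕ
    distExcess v = sumFin (λ x → dist G v x ∸ distLowerBound v x)

    totDist-excess : ∀ v → totDist G v + deg G v + 2 ≡ 2 * n + distExcess v
    totDist-excess v = begin
      totDist G v + deg G v + 2               ≡⟨ cong (λ t → t + deg G v + 2) split ⟩
      distExcess v + Slb + deg G v + 2        ≡⟨ solve 3 (λ e s d → e :+ s :+ d :+ con 2 := (s :+ d :+ con 2) :+ e)
                                                         refl (distExcess v) Slb (deg G v) ⟩
      (Slb + deg G v + 2) + distExcess v      ≡⟨ cong (_+ distExcess v) (sum-distLowerBound v) ⟩
      2 * n + distExcess v                    ∎
      where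
      open ≡-Reasoning
      Slb : ℕ
      Slb = sumFin (distLowerBound v)
      split : totDist G v ≡ distExcess v + Slb
      split = trans (sumFin-cong λ x → sym (m∸n+n≡m (distLowerBound≤dist v x)))
                    (sumFin-distrib-+ (λ x → dist G v x ∸ distLowerBound v x) (distLowerBound v))

    deg≤totDist : ∀ v → deg G v ≤ totDist G v
    deg≤totDist v = sumFin-mono-≤ pointwise
      where
      pointwise : ∀ x → indicator (adj G v x) ≤ dist G v x
      pointwise x with adj G v x in vx
      ... | false = z≤n
      ... | true  = ≢⇒dist≥1 λ { refl → not-¬ vx (irrefl G v) }

  2*wiener≡sumFin-totDist : ∀ {n} (G : Graph n) → 2 * wiener G ≡ sumFin (totDist G)
  2*wiener≡sumFin-totDist G = sumFin-unordered-pairs (dist G) (dist-sym) (dist-self)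
    where open Reachability G

  2*size≡sumFin-deg : ∀ {n} (G : Graph n) → 2 * size G ≡ sumFin (deg G)
  2*size≡sumFin-deg G = trans (cong (2 *_) (sumFin-cong λ u → sumFin-cong (ordered-edge u)))
    (sumFin-unordered-pairs (λ u v → indicator (adj G u v)) (λ u v → cong indicator (Graph.sym G u v))
                            (λ u → cong indicator (irrefl G u)))
    where
    ordered-edge : ∀ u v →
      indicator ((toℕ u <ᵇ toℕ v) ∧ adj G u v) ≡ (if toℕ u <ᵇ toℕ v then indicator (adj G u v) else 0)
    ordered-edge u v with toℕ u <ᵇ toℕ v
    ... | true  = refl
    ... | false = refl

  -- Balls around a vertex of a connected graph

  Tight : ∀ {n} → Graph n → Fin n → Set
  Tight {n} G v = ecc G v + deg G v ≡ n

  module Balls {n} (G : Graph n) (conn : Connected G) where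
    open Reachability G

    ball : ℕ → Fin n → ℕ
    ball k c = count (λ y → R k y c)

    ball-⊆ : ∀ k c → (λ y → R k y c) ⊆ᵇ (λ y → R (suc k) y c)
    ball-⊆ k c y = reach-suc k y c

    ball-0 : ∀ c → ball 0 c ≡ 1
    ball-0 = count-single

    ball-1 : ∀ c → ball 1 c ≡ suc (deg G c)
    ball-1 c = trans (count-cong reach-1≡) (count-insert (adj G c) c (irrefl G c))
      where
      reach-1≡ : ∀ y → R 1 y c ≡ adj G c y ∨ ⌊ y ≟ c ⌋
      reach-1≡ y = bool-ext to from
        where
        to : R 1 y c ≡ true → adj G c y ∨ ⌊ y ≟ c ⌋ ≡ true
        to r with reach-1⇒ y c r
        ... | inj₁ y≡c = ∨-introʳ (adj G c y) (subst (λ x → ⌊ y ≟ x ⌋ ≡ true) y≡c (⌊≟⌋-refl y))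
        ... | inj₂ yc  = ∨-introˡ _ (trans (Graph.sym G c y) yc)
        from : adj G c y ∨ ⌊ y ≟ c ⌋ ≡ true → R 1 y c ≡ true
        from h with ∨-elim {adj G c y} h
        ... | inj₁ cy  = adj⇒reach-1 (trans (Graph.sym G y c) cy)
        ... | inj₂ y≡c rewrite ⌊≟⌋⇒≡ y≡c = ∨-introˡ _ (⌊≟⌋-refl c)

    reach-stable : ∀ k c → (∀ a → R (suc k) a c ≡ true → R k a c ≡ true) →
      ∀ j a → R (k + j) a c ≡ true → R k a c ≡ true
    reach-stable k c stable zero a r = subst (λ i → R i a c ≡ true) (+-identityʳ k) r
    reach-stable k c stable (suc j) a r with reach-step⁻ (k + j) a c (subst (λ i → R i a c ≡ true) (+-suc k j) r)
    ... | inj₁ r′ = reach-stable k c stable j a r′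
    ... | inj₂ (w , aw , r′) = stable a (reach-step k c aw (reach-stable k c stable j w r′))

    ball-grows : ∀ m x c → R m x c ≡ false → ∀ k → k < m → ball k c < ball (suc k) c
    ball-grows m x c ¬r k k<m with any? (λ a → (R (suc k) a c Bool.≟ true) ×-dec (R k a c Bool.≟ false))
    ... | yes (a , new , old) = count-< a (ball-⊆ k c) new old
    ... | no ¬new = ⊥-elim (not-¬ (reach-mono x c (<⇒≤ k<m) (reached x)) ¬r)
      where
      stable : ∀ a → R (suc k) a c ≡ true → R k a c ≡ true
      stable a r = ¬-not λ old → ¬new (a , r , old)
      reached : ∀ a → R k a c ≡ true
      reached a with conn a c
      ... | L , walk with ≤-total L k
      ...   | inj₁ L≤k = reach-mono a c L≤k (walk⇒reach walk)
      ...   | inj₂ k≤L with m≤n⇒∃[o]m+o≡n k≤L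
      ...     | j , refl = reach-stable k c stable j a (walk⇒reach walk)

    ball-growth : ∀ m x c → R m x c ≡ false → ∀ j d → j + d ≤ m → ball j c + d ≤ ball (j + d) c
    ball-growth m x c ¬r j zero _ =
      ≤-reflexive (trans (+-identityʳ _) (cong (λ i → ball i c) (sym (+-identityʳ j))))
    ball-growth m x c ¬r j (suc d) j+d<m = begin
      ball j c + suc d      ≡⟨ +-suc _ d ⟩
      suc (ball j c + d)    ≤⟨ s≤s (ball-growth m x c ¬r j d (≤-trans (+-monoʳ-≤ j (n≤1+n d)) j+d<m)) ⟩
      suc (ball (j + d) c)  ≤⟨ ball-grows m x c ¬r (j + d) (subst (_≤ m) (+-suc j d) j+d<m) ⟩
      ball (suc (j + d)) c  ≡⟨ cong (λ i → ball i c) (+-suc j d) ⟨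
      ball (j + suc d) c    ∎
      where open ≤-Reasoning

    n≡1+[n∸1] : Fin n → n ≡ 1 + (n ∸ 1)
    n≡1+[n∸1] zero    = refl
    n≡1+[n∸1] (suc _) = refl

    reach-all : ∀ x c → R (n ∸ 1) x c ≡ true
    reach-all x c = ¬-not λ ¬r → <-irrefl refl (begin-strict
      n                     ≡⟨ n≡1+[n∸1] x ⟩
      1 + (n ∸ 1)           ≡⟨ cong (_+ (n ∸ 1)) (ball-0 c) ⟨
      ball 0 c + (n ∸ 1)    ≤⟨ ball-growth (n ∸ 1) x c ¬r 0 (n ∸ 1) ≤-refl ⟩
      ball (n ∸ 1) c        <⟨ count<n _ x ¬r ⟩
      n                     ∎)
      where open ≤-Reasoning

    dist≤⇒reach : ∀ {k} u v → dist G u v ≤ k → R k u v ≡ true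
    dist≤⇒reach {k} u v d≤k = ¬-not λ ¬r → <⇒≱ (unreach⇒dist> k u v ¬r (k<n ¬r)) d≤k
      where
      k<n : R k u v ≡ false → k < n
      k<n ¬r = ≰⇒> λ n≤k → not-¬ (reach-mono u v (≤-trans (m∸n≤m n 1) n≤k) (reach-all u v)) ¬r

    dist≡suc⇒unreach : ∀ {k} y c → dist G y c ≡ suc k → R k y c ≡ false
    dist≡suc⇒unreach {k} y c d≡ = ¬-not λ r → 1+n≰n (subst (_≤ k) d≡ (reach⇒dist≤ k y c r))

    farthest : ∀ c → ∃ λ z → dist G z c ≡ ecc G c
    farthest c with maxFin-attained (dist G c) c
    ... | z , dcz≡e = z , trans (dist-sym z c) dcz≡e

    dist≤ecc : ∀ y c → dist G y c ≤ ecc G c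
    dist≤ecc y c = subst (_≤ ecc G c) (dist-sym c y) (maxFin-upper (dist G c) y)

    ecc<n : ∀ c → ecc G c < n
    ecc<n c = subst (ecc G c <_) (sym (n≡1+[n∸1] c))
      (s≤s (maxFin-lub (dist G c) λ y → reach⇒dist≤ (n ∸ 1) c y (reach-all c y)))

    dist<n : ∀ y c → dist G y c < n
    dist<n y c = ≤-<-trans (dist≤ecc y c) (ecc<n c)

    adj⇒dist≤suc : ∀ {y w} c → adj G y w ≡ true → dist G w c ≤ suc (dist G y c)
    adj⇒dist≤suc {y} {w} c yw =
      reach⇒dist≤ _ w c (reach-step (dist G y c) c (trans (Graph.sym G w y) yw) (dist≤⇒reach y c ≤-refl))

    predecessor : ∀ {k} y c → dist G y c ≡ suc k → ∃ λ w → adj G y w ≡ true × dist G w c ≡ k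
    predecessor {k} y c d≡ with reach-step⁻ k y c (dist≤⇒reach y c (≤-reflexive d≡))
    ... | inj₁ r = ⊥-elim (not-¬ r (dist≡suc⇒unreach y c d≡))
    ... | inj₂ (w , yw , r) = w , yw , ≤-antisym (reach⇒dist≤ k w c r) k≤
      where
      k≤ : k ≤ dist G w c
      k≤ = s≤s⁻¹ (subst (_≤ _) d≡ (adj⇒dist≤suc c (trans (Graph.sym G w y) yw)))

    sphere-nonempty : ∀ {k} c → k ≤ ecc G c → ∃ λ y → dist G y c ≡ k
    sphere-nonempty {k} c k≤e with farthest c | m≤n⇒∃[o]m+o≡n k≤e
    ... | z , dz≡e | o , k+o≡e = descend o z (trans dz≡e (sym k+o≡e))
      where
      descend : ∀ o y → dist G y c ≡ k + o → ∃ λ y′ → dist G y′ c ≡ k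
      descend zero    y d≡ = y , trans d≡ (+-identityʳ k)
      descend (suc o) y d≡ with predecessor y c (trans d≡ (+-suc k o))
      ... | w , _ , dw≡ = descend o w dw≡

    ball-room : ∀ c j d → j + d ≡ ecc G c → ball j c + d ≤ n
    ball-room c j zero    _      = subst (_≤ n) (sym (+-identityʳ _)) (count≤n _)
    ball-room c j (suc d) j+d≡e with farthest c
    ... | z , dz≡e = begin
      ball j c + suc d      ≡⟨ +-suc _ d ⟩
      suc (ball j c + d)    ≤⟨ s≤s (ball-growth (j + d) z c ¬r j d ≤-refl) ⟩
      suc (ball (j + d) c)  ≤⟨ count<n _ z ¬r ⟩
      n                       ∎
      where
      open ≤-Reasoning
      ¬r : R (j + d) z c ≡ false
      ¬r = dist≡suc⇒unreach z c (trans dz≡e (trans (sym j+d≡e) (+-suc j d)))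

    ecc+deg≤n : ∀ c → ecc G c + deg G c ≤ n
    ecc+deg≤n c with ecc G c in e
    ... | zero  = count≤n _
    ... | suc k = begin
      suc k + deg G c    ≡⟨ cong suc (+-comm k (deg G c)) ⟩
      suc (deg G c) + k  ≡⟨ cong (_+ k) (ball-1 c) ⟨
      ball 1 c + k         ≤⟨ ball-room c 1 k (sym e) ⟩
      n                    ∎
      where open ≤-Reasoning

    tight-sphere-unique : ∀ {c i y y′} → Tight G c → dist G y c ≡ 2 + i → dist G y′ c ≡ 2 + i → y ≡ y′
    tight-sphere-unique {c} {i} {y} {y′} tight dy dy′
      with y ≟ y′ | m≤n⇒∃[o]m+o≡n (subst (_≤ ecc G c) dy (dist≤ecc y c))
    ... | yes y≡y′ | _ = y≡y′
    ... | no y≢y′ | d , 2+i+d≡e = ⊥-elim (<-irrefl tight (begin-strict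
      ecc G c + deg G c                ≡⟨ cong (_+ deg G c) 2+i+d≡e ⟨
      2 + i + d + deg G c              <⟨ ≤-reflexive (solve 3 (λ i d g → con 1 :+ (con 2 :+ i :+ d :+ g) := con 1 :+ g :+ i :+ con 2 :+ d)
                                                              refl i d (deg G c)) ⟩
      suc (deg G c) + i + 2 + d      ≡⟨ cong (λ b → b + i + 2 + d) (ball-1 c) ⟨
      ball 1 c + i + 2 + d             ≤⟨ +-monoˡ-≤ d (+-monoˡ-≤ 2 (ball-growth (1 + i) y c (dist≡suc⇒unreach y c dy) 1 i ≤-refl)) ⟩
      ball (1 + i) c + 2 + d           ≤⟨ +-monoˡ-≤ d two-new ⟩
      ball (2 + i) c + d               ≤⟨ ball-room c (2 + i) d 2+i+d≡e ⟩
      n                                ∎))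
      where
      open ≤-Reasoning
      two-new : ball (1 + i) c + 2 ≤ ball (2 + i) c
      two-new = count-+-distinct (y ∷ y′ ∷ []) ((y≢y′ ∷ []) ∷ [] ∷ []) (ball-⊆ (1 + i) c)
        ((dist≤⇒reach y c (≤-reflexive dy) , dist≡suc⇒unreach y c dy) ∷
         (dist≤⇒reach y′ c (≤-reflexive dy′) , dist≡suc⇒unreach y′ c dy′) ∷ [])

    dist≡0⇒≡ : ∀ {y c} → dist G y c ≡ 0 → y ≡ c
    dist≡0⇒≡ {y} {c} d≡0 = ⌊≟⌋⇒≡ (dist≤⇒reach y c (≤-reflexive d≡0))

    dist≡1⇒adj : ∀ {y c} → dist G y c ≡ 1 → adj G y c ≡ true
    dist≡1⇒adj {y} {c} d≡1 with predecessor y c d≡1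
    ... | w , yw , dw≡0 = subst (λ w → adj G y w ≡ true) (dist≡0⇒≡ dw≡0) yw

    tight-leaf-dist-injective : ∀ {x} → Tight G x → deg G x ≤ 1 → ∀ y y′ → dist G y x ≡ dist G y′ x → y ≡ y′
    tight-leaf-dist-injective {x} tight deg≤1 y y′ dy≡dy′ with dist G y x in dy
    ... | 0     = trans (dist≡0⇒≡ dy) (sym (dist≡0⇒≡ (sym dy≡dy′)))
    ... | suc (suc i) = tight-sphere-unique tight dy (sym dy≡dy′)
    ... | 1 with y ≟ y′
    ...   | yes y≡y′ = y≡y′
    ...   | no  y≢y′ = case ≤-trans two-neighbours deg≤1 of λ { (s≤s ()) }
      where
      neighbour : ∀ {z} → dist G z x ≡ 1 → adj G x z ≡ true
      neighbour dz = trans (Graph.sym G _ _) (dist≡1⇒adj dz)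
      two-neighbours : 2 ≤ deg G x
      two-neighbours =
        count-≥-distinct (y ∷ y′ ∷ []) ((y≢y′ ∷ []) ∷ [] ∷ []) (neighbour dy ∷ neighbour (sym dy≡dy′) ∷ [])

    tight-farthest-is-leaf : ∀ {c x} → Tight G c → 3 ≤ ecc G c → dist G x c ≡ ecc G c → deg G x ≤ 1
    tight-farthest-is-leaf {c} {x} tight 3≤e dx with m≤n⇒∃[o]m+o≡n 3≤e
    ... | q , 3+q≡e with sphere-nonempty {2 + q} c (≤-trans (n≤1+n _) (≤-reflexive 3+q≡e))
    ...   | a , da = count-≤-cover (adj G x) (a ∷ []) λ w xw → here (tight-sphere-unique tight (dw xw) da)
      where
      dx≡ : dist G x c ≡ 3 + q
      dx≡ = trans dx (sym 3+q≡e)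
      dw : ∀ {w} → adj G x w ≡ true → dist G w c ≡ 2 + q
      dw {w} xw = ≤-antisym (s≤s⁻¹ (≤∧≢⇒< upper not-far)) lower
        where
        lower : 2 + q ≤ dist G w c
        lower = s≤s⁻¹ (subst (_≤ suc (dist G w c)) dx≡ (adj⇒dist≤suc c (trans (Graph.sym G w x) xw)))
        upper : dist G w c ≤ 3 + q
        upper = subst (dist G w c ≤_) (sym 3+q≡e) (dist≤ecc w c)
        not-far : dist G w c ≢ 3 + q
        not-far dw≡ = not-¬ (subst (λ z → adj G x z ≡ true) (tight-sphere-unique tight dw≡ dx≡) xw) (irrefl G x)

  -- Inequality (i)

  module LowerBound {n} (G : Graph n) where
    open Reachability G
    open TotalDistance G

    Δ : ℕ
    Δ = maxDeg G

    slack : Fin n → ℕ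
    slack v = distExcess v + 2 * (Δ ∸ deg G v)

    gap : ℕ
    gap = sumFin (λ v → ecc G v * slack v)

    gap-identity : ξd G + (2 + 2 * Δ) * εG G ≡ ξc G + 2 * n * εG G + gap
    gap-identity = begin
      ξd G + (2 + 2 * Δ) * εG G
        ≡⟨ sumFin-linear (λ v → ecc G v * totDist G v) (2 + 2 * Δ) (ecc G) ⟨
      sumFin (λ v → ecc G v * totDist G v + (2 + 2 * Δ) * ecc G v)
        ≡⟨ sumFin-cong pointwise ⟩
      sumFin (λ v → ecc G v * deg G v + 2 * n * ecc G v + ecc G v * slack v)
        ≡⟨ sumFin-distrib-+ (λ v → ecc G v * deg G v + 2 * n * ecc G v) (λ v → ecc G v * slack v) ⟩
      sumFin (λ v → ecc G v * deg G v + 2 * n * ecc G v) + gap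
        ≡⟨ cong (_+ gap) (sumFin-linear (λ v → ecc G v * deg G v) (2 * n) (ecc G)) ⟩
      ξc G + 2 * n * εG G + gap ∎
      where
      open ≡-Reasoning
      pointwise : ∀ v →
        ecc G v * totDist G v + (2 + 2 * Δ) * ecc G v ≡ ecc G v * deg G v + 2 * n * ecc G v + ecc G v * slack v
      pointwise v = begin
        e * D + (2 + 2 * Δ) * e                 ≡⟨ cong (λ t → e * D + (2 + 2 * t) * e) (m∸n+n≡m (maxFin-upper (deg G) v)) ⟨
        e * D + (2 + 2 * (δ + d)) * e           ≡⟨ solve 4 (λ e D d δ → e :* D :+ (con 2 :+ con 2 :* (δ :+ d)) :* e
                                                          := e :* (D :+ d :+ con 2) :+ e :* d :+ e :* (con 2 :* δ)) refl e D d δ ⟩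
        e * (D + d + 2) + e * d + e * (2 * δ)   ≡⟨ cong (λ t → e * t + e * d + e * (2 * δ)) (totDist-excess v) ⟩
        e * (2 * n + E) + e * d + e * (2 * δ)   ≡⟨ solve 5 (λ e n E d δ → e :* (con 2 :* n :+ E) :+ e :* d :+ e :* (con 2 :* δ)
                                                          := e :* d :+ con 2 :* n :* e :+ e :* (E :+ con 2 :* δ)) refl e n E d δ ⟩
        e * d + 2 * n * e + e * (E + 2 * δ)     ∎
        where
        e D d E δ : ℕ
        e = ecc G v
        D = totDist G v
        d = deg G v
        E = distExcess v
        δ = Δ ∸ d

    ecc≡0⇒sole-vertex : ∀ v → ecc G v ≡ 0 → ∀ x → x ≡ v
    ecc≡0⇒sole-vertex v ecc≡0 x with x ≟ v
    ... | yes x≡v = x≡v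
    ... | no  x≢v =
      case ≤-trans (≢⇒dist≥1 (x≢v ∘ sym)) (subst (dist G v x ≤_) ecc≡0 (maxFin-upper (dist G v) x)) of λ ()

    gap≡0⇒regular∧diam≤2 : gap ≡ 0 → Regular G × diam G ≤ 2
    gap≡0⇒regular∧diam≤2 gap≡0 =
      (Δ , λ v → ≤-antisym (maxFin-upper (deg G) v) (Δ≤deg v)) , maxFin-lub (ecc G) ecc≤2
      where
      ecc≡0⊎slack≡0 : ∀ v → ecc G v ≡ 0 ⊎ slack v ≡ 0
      ecc≡0⊎slack≡0 v = m*n≡0⇒m≡0∨n≡0 (ecc G v) (sumFin≡0⇒≡0 _ gap≡0 v)
      Δ≤deg : ∀ v → Δ ≤ deg G v
      Δ≤deg v with ecc≡0⊎slack≡0 v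
      ... | inj₁ ecc≡0  = maxFin-lub (deg G) λ x → ≤-reflexive (cong (deg G) (ecc≡0⇒sole-vertex v ecc≡0 x))
      ... | inj₂ slack≡0 =
        m∸n≡0⇒m≤n (m*n≡0⇒m≡0 _ 2 (trans (*-comm (Δ ∸ deg G v) 2) (m+n≡0⇒n≡0 (distExcess v) slack≡0)))
      ecc≤2 : ∀ v → ecc G v ≤ 2
      ecc≤2 v with ecc≡0⊎slack≡0 v
      ... | inj₁ ecc≡0   = ≤-trans (≤-reflexive ecc≡0) z≤n
      ... | inj₂ slack≡0 = maxFin-lub (dist G v) λ x →
        ≤-trans (m∸n≡0⇒m≤n (sumFin≡0⇒≡0 _ (m+n≡0⇒m≡0 _ slack≡0) x)) (distLowerBound≤2 v x)

    regular∧diam≤2⇒gap≡0 : Regular G × diam G ≤ 2 → gap ≡ 0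
    regular∧diam≤2⇒gap≡0 ((r , regular) , diam≤2) =
      sumFin-zero λ v → trans (cong (ecc G v *_) (slack≡0 v)) (*-zeroʳ (ecc G v))
      where
      slack≡0 : ∀ v → slack v ≡ 0
      slack≡0 v = cong₂ (λ E δ → E + 2 * δ) excess≡0 δ≡0
        where
        dist≤2 : ∀ x → dist G v x ≤ 2
        dist≤2 x = ≤-trans (maxFin-upper (dist G v) x) (≤-trans (maxFin-upper (ecc G) v) diam≤2)
        excess≡0 : distExcess v ≡ 0
        excess≡0 = sumFin-zero λ x → m≤n⇒m∸n≡0 (≤-reflexive (dist≤2⇒dist≡distLowerBound v x (dist≤2 x)))
        δ≡0 : Δ ∸ deg G v ≡ 0
        δ≡0 = m≤n⇒m∸n≡0 (maxFin-lub (deg G) λ x → ≤-reflexive (trans (regular x) (sym (regular v))))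

    gap≡0⇔regular∧diam≤2 : gap ≡ 0 ⇔ (Regular G × diam G ≤ 2)
    gap≡0⇔regular∧diam≤2 = mk⇔ gap≡0⇒regular∧diam≤2 regular∧diam≤2⇒gap≡0

  -- Inequality (ii)

  nonNeighbours-bound : ∀ {n} (G : Graph n) v (xs : List (Fin n)) → Unique (v ∷ xs) →
    All (λ u → adj G v u ≡ false) xs → deg G v + suc (length xs) ≤ n
  nonNeighbours-bound {n} G v xs unique nonadj = begin
    deg G v + length (v ∷ xs)        ≤⟨ +-monoʳ-≤ (deg G v) (count-≥-distinct (v ∷ xs) unique nonNeighbour) ⟩
    deg G v + count (not ∘ adj G v)  ≡⟨ count-compl (adj G v) ⟩
    n                                ∎
    where
    open ≤-Reasoning
    nonNeighbour : All (λ u → not (adj G v u) ≡ true) (v ∷ xs)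
    nonNeighbour = cong not (irrefl G v) ∷ All.map (cong not) nonadj

  deg+2≤n⇒nonNeighbour : ∀ {n} (G : Graph n) v → deg G v + 2 ≤ n → ∃ λ u → u ≢ v × adj G v u ≡ false
  deg+2≤n⇒nonNeighbour {n} G v deg+2≤n with any? (λ u → ¬? (u ≟ v) ×-dec (adj G v u Bool.≟ false))
  ... | yes found = found
  ... | no none = ⊥-elim (<-irrefl refl (begin-strict
    n                               ≡⟨ count-compl (adj G v) ⟨
    deg G v + count (not ∘ adj G v) ≤⟨ +-monoʳ-≤ (deg G v) (count-≤-cover (not ∘ adj G v) (v ∷ []) only-v) ⟩
    deg G v + 1                     <⟨ +-monoʳ-< (deg G v) ≤-refl ⟩
    deg G v + 2                     ≤⟨ deg+2≤n ⟩
    n                               ∎))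
    where
    open ≤-Reasoning
    only-v : ∀ u → not (adj G v u) ≡ true → u ∈ v ∷ []
    only-v u ¬vu with u ≟ v
    ... | yes u≡v = here u≡v
    ... | no  u≢v = ⊥-elim (none (u , u≢v , not-injective ¬vu))

  dominating⇒totDist≡deg : ∀ {n} (G : Graph n) v → (∀ x → x ≢ v → adj G v x ≡ true) →
    totDist G v ≡ deg G v
  dominating⇒totDist≡deg G v dominating = sumFin-cong pointwise
    where
    open Reachability G
    pointwise : ∀ x → dist G v x ≡ indicator (adj G v x)
    pointwise x with x ≟ v
    ... | yes refl rewrite irrefl G x = dist-self x
    ... | no  x≢v rewrite dominating x x≢v =
      ≤-antisym (adj⇒dist≤1 (dominating x x≢v)) (≢⇒dist≥1 (x≢v ∘ sym))

  NonDominatingTight : ∀ {n} → Graph n → Set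
  NonDominatingTight {n} G = ∀ v → deg G v + 2 ≤ n → Tight G v

  module UpperBound {n} (G : Graph n) (conn : Connected G) where
    open TotalDistance G
    open Balls G conn

    room : Fin n → ℕ
    room v = n ∸ (ecc G v + deg G v)

    gap : ℕ
    gap = sumFin (λ v → room v * (totDist G v ∸ deg G v))

    gap-identity : M₁ G + n * (2 * wiener G) + ξc G ≡ DD G + n * (2 * size G) + ξd G + gap
    gap-identity = begin
      M₁ G + n * (2 * wiener G) + ξc G
        ≡⟨ cong (λ t → M₁ G + n * t + ξc G) (2*wiener≡sumFin-totDist G) ⟩
      M₁ G + n * sumFin (totDist G) + ξc G
        ≡⟨ cong (_+ ξc G) (sumFin-linear (λ v → d v * d v) n (totDist G)) ⟨
      sumFin (λ v → d v * d v + n * D v) + ξc G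
        ≡⟨ sumFin-distrib-+ (λ v → d v * d v + n * D v) (λ v → e v * d v) ⟨
      sumFin (λ v → d v * d v + n * D v + e v * d v)
        ≡⟨ sumFin-cong pointwise ⟩
      sumFin (λ v → d v * D v + n * d v + e v * D v + room v * t v)
        ≡⟨ sumFin-distrib-+ (λ v → d v * D v + n * d v + e v * D v) (λ v → room v * t v) ⟩
      sumFin (λ v → d v * D v + n * d v + e v * D v) + gap
        ≡⟨ cong (_+ gap) (sumFin-distrib-+ (λ v → d v * D v + n * d v) (λ v → e v * D v)) ⟩
      sumFin (λ v → d v * D v + n * d v) + ξd G + gap
        ≡⟨ cong (λ s → s + ξd G + gap) (sumFin-linear (λ v → d v * D v) n d) ⟩
      DD G + n * sumFin (deg G) + ξd G + gap
        ≡⟨ cong (λ t → DD G + n * t + ξd G + gap) (2*size≡sumFin-deg G) ⟨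
      DD G + n * (2 * size G) + ξd G + gap ∎
      where
      open ≡-Reasoning
      e d D : Fin n → ℕ
      e = ecc G
      d = deg G
      D = totDist G
      t : Fin n → ℕ
      t v = D v ∸ d v
      pointwise : ∀ v → d v * d v + n * D v + e v * d v ≡ d v * D v + n * d v + e v * D v + room v * t v
      pointwise v = begin
        d v * d v + n * D v + e v * d v
          ≡⟨ cong₂ (λ N D′ → d v * d v + N * D′ + e v * d v) n≡ D≡ ⟩
        d v * d v + (room v + (e v + d v)) * (t v + d v) + e v * d v
          ≡⟨ solve 4 (λ d e s t → d :* d :+ (s :+ (e :+ d)) :* (t :+ d) :+ e :* d
                         := d :* (t :+ d) :+ (s :+ (e :+ d)) :* d :+ e :* (t :+ d) :+ s :* t) refl (d v) (e v) (room v) (t v) ⟩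
        d v * (t v + d v) + (room v + (e v + d v)) * d v + e v * (t v + d v) + room v * t v
          ≡⟨ cong₂ (λ N D′ → d v * D′ + N * d v + e v * D′ + room v * t v) n≡ D≡ ⟨
        d v * D v + n * d v + e v * D v + room v * t v ∎
        where
        n≡ : n ≡ room v + (e v + d v)
        n≡ = sym (m∸n+n≡m (ecc+deg≤n v))
        D≡ : D v ≡ t v + d v
        D≡ = sym (m∸n+n≡m (deg≤totDist v))

    gap≡0⇒nonDominatingTight : gap ≡ 0 → NonDominatingTight G
    gap≡0⇒nonDominatingTight gap≡0 v deg+2≤n with m*n≡0⇒m≡0∨n≡0 (room v) (sumFin≡0⇒≡0 _ gap≡0 v)
    ... | inj₁ room≡0 = ≤-antisym (ecc+deg≤n v) (m∸n≡0⇒m≤n room≡0)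
    ... | inj₂ t≡0 = ⊥-elim (<-irrefl refl (begin-strict
      2 * n                                  ≤⟨ m≤m+n (2 * n) (distExcess v) ⟩
      2 * n + distExcess v                   ≡⟨ totDist-excess v ⟨
      totDist G v + deg G v + 2              ≤⟨ +-monoˡ-≤ 2 (+-monoˡ-≤ (deg G v) (m∸n≡0⇒m≤n t≡0)) ⟩
      deg G v + deg G v + 2                  <⟨ +-monoʳ-< (deg G v + deg G v) (s≤s (s≤s (s≤s z≤n))) ⟩
      deg G v + deg G v + 4                  ≡⟨ solve 1 (λ d → d :+ d :+ con 4 := con 2 :* (d :+ con 2)) refl (deg G v) ⟩
      2 * (deg G v + 2)                      ≤⟨ *-monoʳ-≤ 2 deg+2≤n ⟩
      2 * n                                  ∎))
      where open ≤-Reasoning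

    nonDominatingTight⇒gap≡0 : NonDominatingTight G → gap ≡ 0
    nonDominatingTight⇒gap≡0 tight = sumFin-zero vertex-term≡0
      where
      vertex-term≡0 : ∀ v → room v * (totDist G v ∸ deg G v) ≡ 0
      vertex-term≡0 v with deg G v + 2 ≤? n
      ... | yes deg+2≤n = cong (_* (totDist G v ∸ deg G v)) (trans (cong (n ∸_) (tight v deg+2≤n)) (n∸n≡0 n))
      ... | no  deg+2≰n = trans (cong (room v *_) totDist∸deg≡0) (*-zeroʳ (room v))
        where
        dominating : ∀ x → x ≢ v → adj G v x ≡ true
        dominating x x≢v = ¬-not λ ¬vx →
          deg+2≰n (nonNeighbours-bound G v (x ∷ []) ((x≢v ∘ sym ∷ []) ∷ [] ∷ []) (¬vx ∷ []))
        totDist∸deg≡0 : totDist G v ∸ deg G v ≡ 0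
        totDist∸deg≡0 = trans (cong (_∸ deg G v) (dominating⇒totDist≡deg G v dominating)) (n∸n≡0 (deg G v))

    gap≡0⇔nonDominatingTight : gap ≡ 0 ⇔ NonDominatingTight G
    gap≡0⇔nonDominatingTight = mk⇔ gap≡0⇒nonDominatingTight nonDominatingTight⇒gap≡0

  walk-map : ∀ {m n} {K : Graph m} {L : Graph n} (f : Fin m → Fin n) →
    (∀ u w → adj K u w ≡ true → adj L (f u) (f w) ≡ true) → ∀ {k u v} → Walk K k u v → Walk L k (f u) (f v)
  walk-map f f-adj here = here
  walk-map f f-adj (step uw walk) = step (f-adj _ _ uw) (walk-map f f-adj walk)

  module Isomorphism {n} (G H : Graph n) (π : Permutation n n)
    (π-adj : ∀ u v → adj H (π ⟨$⟩ʳ u) (π ⟨$⟩ʳ v) ≡ adj G u v) where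
    private
      module RG = Reachability G
      module RH = Reachability H

    reach-≡ : ∀ k u v → reachWithin G k u v ≡ reachWithin H k (π ⟨$⟩ʳ u) (π ⟨$⟩ʳ v)
    reach-≡ k u v = bool-ext to from
      where
      to : reachWithin G k u v ≡ true → reachWithin H k (π ⟨$⟩ʳ u) (π ⟨$⟩ʳ v) ≡ true
      to r with RG.reach⇒walk k u v r
      ... | j , j≤k , walk =
        RH.reach-mono _ _ j≤k (RH.walk⇒reach (walk-map (π ⟨$⟩ʳ_) (λ a b ab → trans (π-adj a b) ab) walk))
      from : reachWithin H k (π ⟨$⟩ʳ u) (π ⟨$⟩ʳ v) ≡ true → reachWithin G k u v ≡ true
      from r with RH.reach⇒walk k _ _ r
      ... | j , j≤k , walk = RG.reach-mono u v j≤k (RG.walk⇒reach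
            (subst₂ (Walk G j) (inverseˡ π) (inverseˡ π) (walk-map (π ⟨$⟩ˡ_) π⁻¹-adj walk)))
        where
        π⁻¹-adj : ∀ a b → adj H a b ≡ true → adj G (π ⟨$⟩ˡ a) (π ⟨$⟩ˡ b) ≡ true
        π⁻¹-adj a b ab = trans (sym (π-adj _ _)) (trans (cong₂ (adj H) (inverseʳ π) (inverseʳ π)) ab)

    dist-≡ : ∀ u v → dist G u v ≡ dist H (π ⟨$⟩ʳ u) (π ⟨$⟩ʳ v)
    dist-≡ u v = count-cong {n} λ i → cong not (reach-≡ (toℕ i) u v)

    deg-≡ : ∀ v → deg G v ≡ deg H (π ⟨$⟩ʳ v)
    deg-≡ v = trans (count-cong λ w → sym (π-adj v w)) (sym (sumFin-permute (indicator ∘ adj H (π ⟨$⟩ʳ v)) π))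

    ecc-≡ : ∀ v → ecc G v ≡ ecc H (π ⟨$⟩ʳ v)
    ecc-≡ v = trans (maxFin-cong (dist-≡ v)) (sym (maxFin-permute (dist H (π ⟨$⟩ʳ v)) π))

    tight-transfer : ∀ v → Tight H (π ⟨$⟩ʳ v) → Tight G v
    tight-transfer v tight = trans (cong₂ _+_ (ecc-≡ v) (deg-≡ v)) tight

  P₄-tight : ∀ j → Tight P₄ j
  P₄-tight zero                   = refl
  P₄-tight (suc zero)             = refl
  P₄-tight (suc (suc zero))       = refl
  P₄-tight (suc (suc (suc zero))) = refl

  ≅P₄⇒tight : ∀ {n} (G : Graph n) → G ≅ P₄ → ∀ v → Tight G v
  ≅P₄⇒tight G (π , π-adj) v with ↔⇒≡ π
  ... | refl = Isomorphism.tight-transfer G P₄ π π-adj v (P₄-tight (π ⟨$⟩ʳ v))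

  -- Joins of a cocktail party graph with a complete graph

  ComplementIsMatching : ∀ {n} → Graph n → Set
  ComplementIsMatching {n} G = ∀ v a b → a ≢ v → b ≢ v → adj G v a ≡ false → adj G v b ≡ false → a ≡ b

  complementIsMatching⇒nonDominatingTight : ∀ {n} (G : Graph n) → Connected G →
    ComplementIsMatching G → NonDominatingTight G
  complementIsMatching⇒nonDominatingTight {n} G conn matching v deg+2≤n with deg+2≤n⇒nonNeighbour G v deg+2≤n
  ... | u , u≢v , ¬vu = ≤-antisym (ecc+deg≤n v) (begin
    n                                ≡⟨ count-compl (adj G v) ⟨
    deg G v + count (not ∘ adj G v)  ≤⟨ +-monoʳ-≤ (deg G v) (count-≤-cover (not ∘ adj G v) (v ∷ u ∷ []) v-or-u) ⟩
    deg G v + 2                      ≤⟨ +-monoʳ-≤ (deg G v) ecc≥2 ⟩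
    deg G v + ecc G v                ≡⟨ +-comm (deg G v) (ecc G v) ⟩
    ecc G v + deg G v                ∎)
    where
    open ≤-Reasoning
    open Reachability G
    open Balls G conn
    ecc≥2 : 2 ≤ ecc G v
    ecc≥2 = ≤-trans (nonadj⇒dist≥2 (u≢v ∘ sym) ¬vu) (maxFin-upper (dist G v) u)
    v-or-u : ∀ x → not (adj G v x) ≡ true → x ∈ v ∷ u ∷ []
    v-or-u x ¬vx with x ≟ v
    ... | yes x≡v = here x≡v
    ... | no  x≢v = there (here (matching v x u x≢v u≢v (not-injective ¬vx) ¬vu))

  half-parity-injective : ∀ a b → a / 2 ≡ b / 2 → a % 2 ≡ b % 2 → a ≡ b
  half-parity-injective a b a≈b a%≡b% =
    trans (m≡m%n+[m/n]*n a 2) (trans (cong₂ (λ r q → r + q * 2) a%≡b% a≈b) (sym (m≡m%n+[m/n]*n b 2)))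

  bits-pigeonhole : ∀ {a b c} → a < 2 → b < 2 → c < 2 → a ≢ b → a ≢ c → b ≡ c
  bits-pigeonhole {0} {0} _ _ _ a≢b _   = ⊥-elim (a≢b refl)
  bits-pigeonhole {1} {1} _ _ _ a≢b _   = ⊥-elim (a≢b refl)
  bits-pigeonhole {0} {1} {0} _ _ _ _ a≢c = ⊥-elim (a≢c refl)
  bits-pigeonhole {1} {0} {1} _ _ _ _ a≢c = ⊥-elim (a≢c refl)
  bits-pigeonhole {0} {1} {1} _ _ _ _ _ = refl
  bits-pigeonhole {1} {0} {0} _ _ _ _ _ = refl
  bits-pigeonhole {suc (suc _)} (s≤s (s≤s ())) _ _ _ _
  bits-pigeonhole {_} {suc (suc _)} _ (s≤s (s≤s ())) _ _ _
  bits-pigeonhole {0} {1} {suc (suc _)} _ _ (s≤s (s≤s ())) _ _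
  bits-pigeonhole {1} {0} {suc (suc _)} _ _ (s≤s (s≤s ())) _ _

  three-distinct-halves : ∀ x y z → x ≢ y → x ≢ z → y ≢ z → x / 2 ≡ y / 2 → x / 2 ≡ z / 2 → ⊥
  three-distinct-halves x y z x≢y x≢z y≢z x≈y x≈z with x % 2 ≟ℕ y % 2 | x % 2 ≟ℕ z % 2
  ... | yes x%≡y% | _         = x≢y (half-parity-injective x y x≈y x%≡y%)
  ... | no _      | yes x%≡z% = x≢z (half-parity-injective x z x≈z x%≡z%)
  ... | no x%≢y%  | no x%≢z%  = y≢z (half-parity-injective y z (trans (sym x≈y) x≈z)
                                   (bits-pigeonhole (m%n<n x 2) (m%n<n y 2) (m%n<n z 2) x%≢y% x%≢z%))

  cpAdj-false⇒same-half : ∀ {n} k {u v : Fin n} → u ≢ v → cpAdj n k u v ≡ false → toℕ u / 2 ≡ toℕ v / 2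
  cpAdj-false⇒same-half k {u} {v} u≢v ¬uv rewrite ⌊≟⌋-≢ u≢v =
    ≡ᵇ⇒≡ _ _ (≡true⇒T (∧-conicalʳ (toℕ v <ᵇ 2 * k) _ (∧-conicalʳ (toℕ u <ᵇ 2 * k) _ (not-injective ¬uv))))

  cpJoin⇒complementIsMatching : ∀ {n} (G : Graph n) → IsCPJoin G → ComplementIsMatching G
  cpJoin⇒complementIsMatching G (k , _ , π , π-adj) v a b a≢v b≢v ¬va ¬vb with a ≟ b
  ... | yes a≡b = a≡b
  ... | no  a≢b = ⊥-elim (three-distinct-halves (toℕ (π ⟨$⟩ʳ v)) (toℕ (π ⟨$⟩ʳ a)) (toℕ (π ⟨$⟩ʳ b))
                    (distinct (a≢v ∘ sym)) (distinct (b≢v ∘ sym)) (distinct a≢b)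
                    (cpAdj-false⇒same-half k (π-distinct (a≢v ∘ sym)) (trans (π-adj v a) ¬va))
                    (cpAdj-false⇒same-half k (π-distinct (b≢v ∘ sym)) (trans (π-adj v b) ¬vb)))
    where
    π-distinct : ∀ {x y} → x ≢ y → π ⟨$⟩ʳ x ≢ π ⟨$⟩ʳ y
    π-distinct x≢y = x≢y ∘ Injection.injective (↔⇒↣ π)
    distinct : ∀ {x y} → x ≢ y → toℕ (π ⟨$⟩ʳ x) ≢ toℕ (π ⟨$⟩ʳ y)
    distinct x≢y = π-distinct x≢y ∘ toℕ-injective

  comap : ∀ {m n} → (Fin m → Fin n) → Graph n → Graph m
  comap f G = record
    { adj    = λ u v → adj G (f u) (f v)
    ; sym    = λ u v → Graph.sym G (f u) (f v)
    ; irrefl = λ v → irrefl G (f v)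
    }

  complementIsMatching-comap : ∀ {m n} (G : Graph n) (f : Fin m → Fin n) → (∀ {u v} → f u ≡ f v → u ≡ v) →
    ComplementIsMatching G → ComplementIsMatching (comap f G)
  complementIsMatching-comap G f f-injective matching v a b a≢v b≢v ¬va ¬vb =
    f-injective (matching (f v) (f a) (f b) (a≢v ∘ f-injective) (b≢v ∘ f-injective) ¬va ¬vb)

  complete⇒cpJoin : ∀ {n} (G : Graph n) → (∀ a b → a ≢ b → adj G a b ≡ true) → IsCPJoin G
  complete⇒cpJoin {n} G complete = 0 , z≤n , Perm.id , cp-adj
    where
    cp-adj : ∀ u v → cpAdj n 0 u v ≡ adj G u v
    cp-adj u v with u ≟ v
    ... | yes refl = sym (irrefl G u)
    ... | no  u≢v  = sym (complete u v u≢v)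

  cpJoin-relabel : ∀ {n} (G : Graph n) (σ : Permutation n n) → IsCPJoin (comap (σ ⟨$⟩ʳ_) G) → IsCPJoin G
  cpJoin-relabel G σ (k , 2k≤n , π , π-adj) =
    k , 2k≤n , Perm.flip σ Perm.∘ₚ π ,
    λ u v → trans (π-adj (σ ⟨$⟩ˡ u) (σ ⟨$⟩ˡ v)) (cong₂ (adj G) (inverseʳ σ) (inverseʳ σ))

  pair-to-front : ∀ {m} (a b : Fin (2 + m)) → a ≢ b →
    Σ (Permutation (2 + m) (2 + m)) λ σ → σ ⟨$⟩ʳ zero ≡ a × σ ⟨$⟩ʳ suc zero ≡ b
  -- 1 is sent to punchIn a (punchOut a≢b), which is b.
  pair-to-front a b a≢b = Perm.insert zero a (Perm.insert zero (punchOut a≢b) Perm.id) , refl , punchIn-punchOut a≢b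

  module _ (m k : ℕ) where
    private
      -- the normal form of 2 * suc k
      2[1+k] : k + suc (k + 0) ≡ suc (k + (k + 0))
      2[1+k] = +-suc k (k + 0)
      [2+a]/2 : ∀ a → (2 + a) / 2 ≡ suc (a / 2)
      [2+a]/2 a = m/n≡1+[m∸n]/n {2 + a} {2} (s≤s (s≤s z≤n))

    cpAdj-shift : ∀ x y → cpAdj (2 + m) (suc k) (suc (suc x)) (suc (suc y)) ≡ cpAdj m k x y
    cpAdj-shift x y rewrite 2[1+k] | [2+a]/2 (toℕ x) | [2+a]/2 (toℕ y)
      | ⌊suc≟suc⌋ (suc x) (suc y) | ⌊suc≟suc⌋ x y = refl

    cpAdj-01 : cpAdj (2 + m) (suc k) zero (suc zero) ≡ false
    cpAdj-01 rewrite 2[1+k] = refl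

    cpAdj-10 : cpAdj (2 + m) (suc k) (suc zero) zero ≡ false
    cpAdj-10 rewrite 2[1+k] = refl

    cpAdj-0s : ∀ y → cpAdj (2 + m) (suc k) zero (suc (suc y)) ≡ true
    cpAdj-0s y rewrite 2[1+k] | [2+a]/2 (toℕ y) | Bool.∧-zeroʳ (toℕ y <ᵇ 2 * k) = refl

    cpAdj-1s : ∀ y → cpAdj (2 + m) (suc k) (suc zero) (suc (suc y)) ≡ true
    cpAdj-1s y rewrite 2[1+k] | [2+a]/2 (toℕ y) | Bool.∧-zeroʳ (toℕ y <ᵇ 2 * k) = refl

    cpAdj-s0 : ∀ y → cpAdj (2 + m) (suc k) (suc (suc y)) zero ≡ true
    cpAdj-s0 y rewrite 2[1+k] | [2+a]/2 (toℕ y) | Bool.∧-zeroʳ (toℕ y <ᵇ 2 * k) = refl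

    cpAdj-s1 : ∀ y → cpAdj (2 + m) (suc k) (suc (suc y)) (suc zero) ≡ true
    cpAdj-s1 y rewrite 2[1+k] | [2+a]/2 (toℕ y) | Bool.∧-zeroʳ (toℕ y <ᵇ 2 * k) = refl

  cpJoin-extend : ∀ {m} (G : Graph (2 + m)) → adj G zero (suc zero) ≡ false →
    (∀ j → adj G zero (suc (suc j)) ≡ true) → (∀ j → adj G (suc zero) (suc (suc j)) ≡ true) →
    IsCPJoin (comap (λ i → suc (suc i)) G) → IsCPJoin G
  cpJoin-extend {m} G ¬01 0-rest 1-rest (k , 2k≤m , π , π-adj) =
    suc k , subst (_≤ 2 + m) (sym (*-suc 2 k)) (s≤s (s≤s 2k≤m)) , Perm.lift₀ (Perm.lift₀ π) , cp-adj
    where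
    cp-adj : ∀ u v → cpAdj (2 + m) (suc k) (Perm.lift₀ (Perm.lift₀ π) ⟨$⟩ʳ u) (Perm.lift₀ (Perm.lift₀ π) ⟨$⟩ʳ v)
                     ≡ adj G u v
    cp-adj zero          zero          = sym (irrefl G zero)
    cp-adj zero          (suc zero)    = trans (cpAdj-01 m k) (sym ¬01)
    cp-adj zero          (suc (suc j)) = trans (cpAdj-0s m k _) (sym (0-rest j))
    cp-adj (suc zero)    zero          = trans (cpAdj-10 m k) (sym (trans (Graph.sym G _ _) ¬01))
    cp-adj (suc zero)    (suc zero)    = sym (irrefl G (suc zero))
    cp-adj (suc zero)    (suc (suc j)) = trans (cpAdj-1s m k _) (sym (1-rest j))
    cp-adj (suc (suc i)) zero          = trans (cpAdj-s0 m k _) (sym (trans (Graph.sym G _ _) (0-rest i)))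
    cp-adj (suc (suc i)) (suc zero)    = trans (cpAdj-s1 m k _) (sym (trans (Graph.sym G _ _) (1-rest i)))
    cp-adj (suc (suc i)) (suc (suc j)) = trans (cpAdj-shift m k _ _) (π-adj i j)

  complementIsMatching⇒cpJoin : ∀ {n} (G : Graph n) → ComplementIsMatching G → IsCPJoin G
  nonEdge⇒cpJoin : ∀ {n} (G : Graph n) → ComplementIsMatching G →
    ∀ a b → a ≢ b → adj G a b ≡ false → IsCPJoin G

  complementIsMatching⇒cpJoin G matching with any? (λ a → any? (λ b → ¬? (a ≟ b) ×-dec (adj G a b Bool.≟ false)))
  ... | yes (a , b , a≢b , ¬ab) = nonEdge⇒cpJoin G matching a b a≢b ¬ab
  ... | no  none = complete⇒cpJoin G λ a b a≢b → ¬-not λ ¬ab → none (a , b , a≢b , ¬ab)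

  nonEdge⇒cpJoin {1} G _ zero zero a≢b _ = ⊥-elim (a≢b refl)
  nonEdge⇒cpJoin {suc (suc m)} G matching a b a≢b ¬ab with pair-to-front a b a≢b
  ... | σ , σ0≡a , σ1≡b = cpJoin-relabel G σ (cpJoin-extend G′ ¬01 0-rest 1-rest
                            (complementIsMatching⇒cpJoin (comap (λ i → suc (suc i)) G′)
                              (complementIsMatching-comap G′ (λ i → suc (suc i)) (λ e → Fin.suc-injective (Fin.suc-injective e)) matching′)))
    where
    G′ : Graph (2 + m)
    G′ = comap (σ ⟨$⟩ʳ_) G
    matching′ : ComplementIsMatching G′
    matching′ = complementIsMatching-comap G (σ ⟨$⟩ʳ_) (Injection.injective (↔⇒↣ σ)) matching
    ¬01 : adj G′ zero (suc zero) ≡ false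
    ¬01 = trans (cong₂ (adj G) σ0≡a σ1≡b) ¬ab
    0-rest : ∀ j → adj G′ zero (suc (suc j)) ≡ true
    0-rest j = ¬-not λ ¬0j → case matching′ zero (suc (suc j)) (suc zero) (λ ()) (λ ()) ¬0j ¬01 of λ ()
    1-rest : ∀ j → adj G′ (suc zero) (suc (suc j)) ≡ true
    1-rest j = ¬-not λ ¬1j →
      case matching′ (suc zero) (suc (suc j)) zero (λ ()) (λ ()) ¬1j (trans (Graph.sym G′ _ _) ¬01) of λ ()

  -- Graphs with a vertex of degree at most n − 3

  Consecutive : ℕ → ℕ → Set
  Consecutive a b = suc a ≡ b ⊎ suc b ≡ a

  adj-P₄⇔consecutive : ∀ i j → adj P₄ i j ≡ true ⇔ Consecutive (toℕ i) (toℕ j)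
  adj-P₄⇔consecutive i j = mk⇔ to from
    where
    to : adj P₄ i j ≡ true → Consecutive (toℕ i) (toℕ j)
    to h with ∨-elim h
    ... | inj₁ e = inj₁ (≡ᵇ⇒≡ _ _ (≡true⇒T e))
    ... | inj₂ e = inj₂ (≡ᵇ⇒≡ _ _ (≡true⇒T e))
    from : Consecutive (toℕ i) (toℕ j) → adj P₄ i j ≡ true
    from (inj₁ e) = ∨-introˡ _ (T⇒≡true (≡⇒≡ᵇ _ _ e))
    from (inj₂ e) = ∨-introʳ (suc (toℕ i) ≡ᵇ toℕ j) (T⇒≡true (≡⇒≡ᵇ _ _ e))

  module UniqueDistances {n} (G : Graph n) (conn : Connected G) (x : Fin n)
    (dist-injective : ∀ y y′ → dist G y x ≡ dist G y′ x → y ≡ y′) where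
    open Reachability G
    open Balls G conn

    adj⇔consecutive : ∀ u v → adj G u v ≡ true ⇔ Consecutive (dist G u x) (dist G v x)
    adj⇔consecutive u v = mk⇔ to from
      where
      to : adj G u v ≡ true → Consecutive (dist G u x) (dist G v x)
      to uv with <-cmp (dist G u x) (dist G v x)
      ... | tri< du<dv _ _ = inj₁ (≤-antisym du<dv (adj⇒dist≤suc x uv))
      ... | tri≈ _ du≡dv _ =
        ⊥-elim (not-¬ (subst (λ w → adj G u w ≡ true) (sym (dist-injective u v du≡dv)) uv) (irrefl G u))
      ... | tri> _ _ dv<du = inj₂ (≤-antisym dv<du (adj⇒dist≤suc x (trans (Graph.sym G v u) uv)))
      from : Consecutive (dist G u x) (dist G v x) → adj G u v ≡ true
      from (inj₁ dv≡) with predecessor v x (sym dv≡)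
      ... | w , vw , dw≡ = trans (Graph.sym G u v) (subst (λ z → adj G v z ≡ true) (dist-injective w u dw≡) vw)
      from (inj₂ du≡) with predecessor u x (sym du≡)
      ... | w , uw , dw≡ = subst (λ z → adj G u z ≡ true) (dist-injective w v dw≡) uw

    -- On a path y₀ = x, y₁, y₂, … with at least five vertices, both x and y₄ are at distance 2 from y₂.
    long-path-not-tight : NonDominatingTight G → 4 ≤ ecc G x → ⊥
    long-path-not-tight tight 4≤e = from-spheres (sphere-nonempty x (≤-trans (n≤1+n 2) (≤-trans (n≤1+n 3) 4≤e)))
                                                 (sphere-nonempty x 4≤e)
      where
      adj-at : ∀ {u v a b} → dist G u x ≡ a → dist G v x ≡ b → adj G u v ≡ true → Consecutive a b
      adj-at refl refl uv = Equivalence.to (adj⇔consecutive _ _) uv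
      from-spheres : (∃ λ y₂ → dist G y₂ x ≡ 2) → (∃ λ y₄ → dist G y₄ x ≡ 4) → ⊥
      from-spheres (y₂ , y₂-dist) (y₄ , y₄-dist) = x≢y₄ (tight-sphere-unique (tight y₂ deg₂+2≤n) dx₂ d₄₂)
        where
        x≢y₄ : x ≢ y₄
        x≢y₄ x≡y₄ = case trans (sym (dist-self x)) (trans (cong (λ z → dist G z x) x≡y₄) y₄-dist) of λ ()
        dx₂ : dist G x y₂ ≡ 2
        dx₂ = trans (dist-sym x y₂) y₂-dist
        y₂≢x : y₂ ≢ x
        y₂≢x y₂≡x = case trans (sym y₂-dist) (trans (cong (λ z → dist G z x) y₂≡x) (dist-self x)) of λ ()
        ¬y₂x : adj G y₂ x ≡ false
        ¬y₂x = ¬-not λ y₂x → case adj-at y₂-dist (dist-self x) y₂x of λ { (inj₁ ()) ; (inj₂ ()) }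
        deg₂+2≤n : deg G y₂ + 2 ≤ n
        deg₂+2≤n = nonNeighbours-bound G y₂ (x ∷ []) ((y₂≢x ∷ []) ∷ [] ∷ []) (¬y₂x ∷ [])
        y₄≢y₂ : y₄ ≢ y₂
        y₄≢y₂ y₄≡y₂ = case trans (sym y₄-dist) (trans (cong (λ z → dist G z x) y₄≡y₂) y₂-dist) of λ ()
        ¬y₄y₂ : adj G y₄ y₂ ≡ false
        ¬y₄y₂ = ¬-not λ y₄y₂ → case adj-at y₄-dist y₂-dist y₄y₂ of λ { (inj₁ ()) ; (inj₂ ()) }
        via-predecessor : (∃ λ w → adj G y₄ w ≡ true × dist G w x ≡ 3) → dist G y₄ y₂ ≤ 2
        via-predecessor (w , y₄w , dw) = common-neighbour⇒dist≤2 y₄w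
          (Equivalence.from (adj⇔consecutive w y₂) (inj₂ (trans (cong suc y₂-dist) (sym dw))))
        d₄₂ : dist G y₄ y₂ ≡ 2
        d₄₂ = ≤-antisym (via-predecessor (predecessor y₄ x y₄-dist)) (nonadj⇒dist≥2 y₄≢y₂ ¬y₄y₂)

  -- The isomorphism sends each vertex v to dist v x.
  unique-distances⇒≅P₄ : ∀ {n} (G : Graph n) → n ≡ 4 → Connected G → ∀ x →
    (∀ y y′ → dist G y x ≡ dist G y′ x → y ≡ y′) → 3 ≤ ecc G x → G ≅ P₄
  unique-distances⇒≅P₄ {n} G n≡4 conn x dist-injective 3≤e =
    permutation to from to∘from from∘to , adj-preserved
    where
    open Balls G conn
    open UniqueDistances G conn x dist-injective
    dist<4 : ∀ v → dist G v x < 4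
    dist<4 v = subst (dist G v x <_) n≡4 (dist<n v x)
    to : Fin n → Fin 4
    to v = fromℕ< (dist<4 v)
    toℕ-to : ∀ v → toℕ (to v) ≡ dist G v x
    toℕ-to v = toℕ-fromℕ< (dist<4 v)
    sphere : ∀ (k : Fin 4) → ∃ λ y → dist G y x ≡ toℕ k
    sphere k = sphere-nonempty x (≤-trans (s≤s⁻¹ (toℕ<n k)) 3≤e)
    from : Fin 4 → Fin n
    from k = proj₁ (sphere k)
    to∘from : ∀ k → to (from k) ≡ k
    to∘from k = toℕ-injective (trans (toℕ-to (from k)) (proj₂ (sphere k)))
    from∘to : ∀ v → from (to v) ≡ v
    from∘to v = dist-injective _ _ (trans (proj₂ (sphere (to v))) (toℕ-to v))
    adj-preserved : ∀ u v → adj P₄ (to u) (to v) ≡ adj G u v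
    adj-preserved u v = bool-ext
      (λ h → Equivalence.from (adj⇔consecutive u v)
               (subst₂ Consecutive (toℕ-to u) (toℕ-to v) (Equivalence.to (adj-P₄⇔consecutive (to u) (to v)) h)))
      (λ uv → Equivalence.from (adj-P₄⇔consecutive (to u) (to v))
               (subst₂ Consecutive (sym (toℕ-to u)) (sym (toℕ-to v)) (Equivalence.to (adj⇔consecutive u v) uv)))

  lowDegree⇒≅P₄ : ∀ {n} (G : Graph n) → Connected G → NonDominatingTight G →
    ∀ c → deg G c + 3 ≤ n → G ≅ P₄
  lowDegree⇒≅P₄ {n} G conn tight c deg+3≤n = by-order (n ≟ℕ 4)
    where
    open Balls G conn
    tight-c : Tight G c
    tight-c = tight c (≤-trans (+-monoʳ-≤ (deg G c) (n≤1+n 2)) deg+3≤n)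
    3≤eccᶜ : 3 ≤ ecc G c
    3≤eccᶜ = +-cancelʳ-≤ (deg G c) 3 (ecc G c) (subst₂ _≤_ (+-comm (deg G c) 3) (sym tight-c) deg+3≤n)
    4≤n : 4 ≤ n
    4≤n = ≤-trans (+-monoˡ-≤ 3 1≤degᶜ) deg+3≤n
      where
      1≤degᶜ : 1 ≤ deg G c
      1≤degᶜ = +-cancelˡ-< (ecc G c) 0 (deg G c) (subst₂ _<_ (sym (+-identityʳ (ecc G c))) (sym tight-c) (ecc<n c))
    x : Fin n
    x = proj₁ (farthest c)
    leaf : deg G x ≤ 1
    leaf = tight-farthest-is-leaf tight-c 3≤eccᶜ (proj₂ (farthest c))
    tight-x : Tight G x
    tight-x = tight x (≤-trans (+-monoˡ-≤ 2 leaf) (≤-trans (n≤1+n 3) 4≤n))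
    leaf-dist-injective : ∀ y y′ → dist G y x ≡ dist G y′ x → y ≡ y′
    leaf-dist-injective = tight-leaf-dist-injective tight-x leaf
    n≤1+eccₓ : n ≤ suc (ecc G x)
    n≤1+eccₓ = subst₂ _≤_ tight-x (+-comm (ecc G x) 1) (+-monoʳ-≤ (ecc G x) leaf)
    by-order : Dec (n ≡ 4) → G ≅ P₄
    by-order (yes n≡4) =
      unique-distances⇒≅P₄ G n≡4 conn x leaf-dist-injective (s≤s⁻¹ (subst (_≤ suc (ecc G x)) n≡4 n≤1+eccₓ))
    by-order (no  n≢4) = ⊥-elim (UniqueDistances.long-path-not-tight G conn x leaf-dist-injective tight
                                   (s≤s⁻¹ (≤-trans (≤∧≢⇒< 4≤n (n≢4 ∘ sym)) n≤1+eccₓ)))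

  nonDominatingTight⇔P₄⊎cpJoin : ∀ {n} (G : Graph n) → Connected G →
    NonDominatingTight G ⇔ (G ≅ P₄ ⊎ IsCPJoin G)
  nonDominatingTight⇔P₄⊎cpJoin {n} G conn = mk⇔ to from
    where
    to : NonDominatingTight G → G ≅ P₄ ⊎ IsCPJoin G
    to tight with any? (λ c → deg G c + 3 ≤? n)
    ... | yes (c , deg+3≤n) = inj₁ (lowDegree⇒≅P₄ G conn tight c deg+3≤n)
    ... | no  none = inj₂ (complementIsMatching⇒cpJoin G matching)
      where
      matching : ComplementIsMatching G
      matching v a b a≢v b≢v ¬va ¬vb with a ≟ b
      ... | yes a≡b = a≡b
      ... | no  a≢b = ⊥-elim (none (v , nonNeighbours-bound G v (a ∷ b ∷ [])
                                          ((a≢v ∘ sym ∷ b≢v ∘ sym ∷ []) ∷ (a≢b ∷ []) ∷ [] ∷ []) (¬va ∷ ¬vb ∷ [])))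
    from : G ≅ P₄ ⊎ IsCPJoin G → NonDominatingTight G
    from (inj₁ G≅P₄) v _ = ≅P₄⇒tight G G≅P₄ v
    from (inj₂ cpJoin) = complementIsMatching⇒nonDominatingTight G conn (cpJoin⇒complementIsMatching G cpJoin)

-- Integer form of the two inequalities
import Data.Nat as ℕ
open import Data.Nat using (ℕ; _≤_; z≤n)
open import Data.Integer using (ℤ; +_; _-_; _*_; _+_)
import Data.Integer
import Data.Integer.Properties as ℤ
open import Data.Integer.Solver using (module +-*-Solver)
open import Data.Product using (_×_; _,_; map₂)
open import Data.Sum using (_⊎_)
open import Function using (_⇔_; mk⇔)
import Function.Properties.Equivalence as ⇔
open import Relation.Binary.PropositionalEquality using (_≡_; refl; sym; trans; cong; cong₂; subst; module ≡-Reasoning)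

open +-*-Solver

ℤ-difference : ∀ a b c d {x} → a ℕ.+ d ≡ b ℕ.+ c ℕ.+ x → (+ a - + b) - (+ c - + d) ≡ + x
ℤ-difference a b c d {x} eq = begin
  (+ a - + b) - (+ c - + d)        ≡⟨ solve 4 (λ a b c d → (a :- b) :- (c :- d) := (a :+ d) :- (b :+ c))
                                             refl (+ a) (+ b) (+ c) (+ d) ⟩
  + (a ℕ.+ d) - + (b ℕ.+ c)        ≡⟨ cong (λ t → + t - + (b ℕ.+ c)) eq ⟩
  + (b ℕ.+ c ℕ.+ x) - + (b ℕ.+ c)  ≡⟨ solve 2 (λ y x → (y :+ x) :- y := x) refl (+ (b ℕ.+ c)) (+ x) ⟩
  + x                              ∎
  where open ≡-Reasoning

difference-gap : ∀ {i j : ℤ} {x} {P : Set} → i - j ≡ + x → (x ≡ 0 ⇔ P) →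
  j Data.Integer.≤ i × (i ≡ j ⇔ P)
difference-gap {i} {j} {x} eq x≡0⇔P =
  ℤ.0≤i-j⇒j≤i (subst (+ 0 Data.Integer.≤_) (sym eq) (Data.Integer.+≤+ z≤n)) , ⇔.trans (mk⇔ to from) x≡0⇔P
  where
  to : i ≡ j → x ≡ 0
  to refl = ℤ.+-injective (trans (sym eq) (ℤ.+-inverseʳ i))
  from : x ≡ 0 → i ≡ j
  from refl = ℤ.i-j≡0⇒i≡j i j eq

lower-bound : ∀ {n} (G : Graph n) →
  (+ ξd G - + ξc G Data.Integer.≥ + 2 * (+ n - + 1 - + maxDeg G) * + εG G)
  × ((+ ξd G - + ξc G ≡ + 2 * (+ n - + 1 - + maxDeg G) * + εG G) ⇔ (Regular G × diam G ≤ 2))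
lower-bound {n} G = difference-gap gap-as-difference (LowerBound.gap≡0⇔regular∧diam≤2 G)
  where
  open ≡-Reasoning
  Δ ε : ℕ
  Δ = maxDeg G
  ε = εG G
  bound : + 2 * (+ n - + 1 - + Δ) * + ε ≡ + (2 ℕ.* n ℕ.* ε) - + ((2 ℕ.+ 2 ℕ.* Δ) ℕ.* ε)
  bound = begin
    + 2 * (+ n - + 1 - + Δ) * + ε
      ≡⟨ solve 3 (λ n Δ ε → con (+ 2) :* (n :- con (+ 1) :- Δ) :* ε
                         := con (+ 2) :* n :* ε :- (con (+ 2) :+ con (+ 2) :* Δ) :* ε)
                 refl (+ n) (+ Δ) (+ ε) ⟩
    + 2 * + n * + ε - (+ 2 + + 2 * + Δ) * + ε
      ≡⟨ cong₂ _-_ (trans (ℤ.pos-* (2 ℕ.* n) ε) (cong (_* + ε) (ℤ.pos-* 2 n)))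
                   (trans (ℤ.pos-* (2 ℕ.+ 2 ℕ.* Δ) ε) (cong (λ t → (+ 2 + t) * + ε) (ℤ.pos-* 2 Δ))) ⟨
    + (2 ℕ.* n ℕ.* ε) - + ((2 ℕ.+ 2 ℕ.* Δ) ℕ.* ε) ∎
  gap-as-difference : (+ ξd G - + ξc G) - + 2 * (+ n - + 1 - + Δ) * + ε ≡ + LowerBound.gap G
  gap-as-difference = trans (cong ((+ ξd G - + ξc G) -_) bound)
    (ℤ-difference (ξd G) (ξc G) (2 ℕ.* n ℕ.* ε) ((2 ℕ.+ 2 ℕ.* Δ) ℕ.* ε) (LowerBound.gap-identity G))

upper-bound : ∀ {n} (G : Graph n) → Connected G →
  (+ ξd G - + ξc G Data.Integer.≤ + 2 * + n * (+ wiener G - + size G) + + M₁ G - + DD G)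
  × ((+ ξd G - + ξc G ≡ + 2 * + n * (+ wiener G - + size G) + + M₁ G - + DD G) ⇔ (G ≅ P₄ ⊎ IsCPJoin G))
upper-bound {n} G conn = map₂ (⇔.trans (mk⇔ sym sym))
  (difference-gap gap-as-difference
    (⇔.trans (UpperBound.gap≡0⇔nonDominatingTight G conn) (nonDominatingTight⇔P₄⊎cpJoin G conn)))
  where
  open ≡-Reasoning
  W m : ℕ
  W = wiener G
  m = size G
  cast : ∀ a → + n * (+ 2 * + a) ≡ + (n ℕ.* (2 ℕ.* a))
  cast a = sym (trans (ℤ.pos-* n (2 ℕ.* a)) (cong (+ n *_) (ℤ.pos-* 2 a)))
  bound : + 2 * + n * (+ W - + m) + + M₁ G - + DD G ≡ + (M₁ G ℕ.+ n ℕ.* (2 ℕ.* W)) - + (DD G ℕ.+ n ℕ.* (2 ℕ.* m))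
  bound = begin
    + 2 * + n * (+ W - + m) + + M₁ G - + DD G
      ≡⟨ solve 5 (λ n W m M D → con (+ 2) :* n :* (W :- m) :+ M :- D := (M :+ n :* (con (+ 2) :* W)) :- (D :+ n :* (con (+ 2) :* m)))
                 refl (+ n) (+ W) (+ m) (+ M₁ G) (+ DD G) ⟩
    (+ M₁ G + + n * (+ 2 * + W)) - (+ DD G + + n * (+ 2 * + m))
      ≡⟨ cong₂ (λ s t → (+ M₁ G + s) - (+ DD G + t)) (cast W) (cast m) ⟩
    + (M₁ G ℕ.+ n ℕ.* (2 ℕ.* W)) - + (DD G ℕ.+ n ℕ.* (2 ℕ.* m)) ∎
  gap-as-difference : (+ 2 * + n * (+ W - + m) + + M₁ G - + DD G) - (+ ξd G - + ξc G) ≡ + UpperBound.gap G conn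
  gap-as-difference = trans (cong (_- (+ ξd G - + ξc G)) bound)
    (ℤ-difference (M₁ G ℕ.+ n ℕ.* (2 ℕ.* W)) (DD G ℕ.+ n ℕ.* (2 ℕ.* m)) (ξd G) (ξc G) (UpperBound.gap-identity G conn))

theorem2p1 : ∀ {n : ℕ} (G : Graph n) → Connected G →
    ((+ ξd G - + ξc G Data.Integer.≥ + 2 * (+ n - + 1 - + maxDeg G) * + εG G)
    × ((+ ξd G - + ξc G ≡ + 2 * (+ n - + 1 - + maxDeg G) * + εG G)
    ⇔ (Regular G × diam G ≤ 2)))
    × ((+ ξd G - + ξc G Data.Integer.≤ + 2 * + n * (+ wiener G - + size G) + + M₁ G - + DD G)
    × ((+ ξd G - + ξc G ≡ + 2 * + n * (+ wiener G - + size G) + + M₁ G - + DD G)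
    ⇔ (G ≅ P₄ ⊎ IsCPJoin G)))
theorem2p1 G conn = lower-bound G , upper-bound G conn
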